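{- Let $B_1,B_2,\dots$ be a sequence of benzenoid chains where $B_h$ has $h$ hexagons and, for $h\ge2$, $B_h$ is obtained from $B_{h-1}$ by annelating a hexagon over an edge $e_{h-1}=u_{h-1}v_{h-1}$ of the $(h-1)$st hexagon whose end-vertices have degree $2$ in $B_{h-1}$, i.e. by adding new vertices $p,q,r,s$ and edges $u_{h-1}p,pq,qr,rs,sv_{h-1}$. For $h=1$, regard $B_1$ as the $6$-cycle $u_0\,p\,q\,r\,s\,v_0\,u_0$ (with $e_0=u_0v_0$). For each $h\ge1$ the edge $e_h=u_hv_h$ of the $h$th hexagon (used for the next annelation) is one of three types: Case 1: $(u_h,v_h)=(p,q)$; Case 2: $(u_h,v_h)=(q,r)$; Case 3: $(u_h,v_h)=(r,s)$, where $p,q,r,s$ are the vertices added at step $h$. Write $\alpha_h=H_e(B_h,x)$, $\beta_h=H_e(B_h,u_h,x)$, $\gamma_h=H_e(B_h,v_h,x)$, $\delta_h=H_e(B_h,e_h,x)$, and set $\alpha_0=\beta_0=\gamma_0=\delta_0=1$. Then for all $h\ge1$, $$\alpha_h=\alpha_{h-1}+(x+x^2)(\beta_{h-1}+\gamma_{h-1})+x^2\delta_{h-1}+5+4x+3x^2+3x^3,$$ and, according to the case of $e_h$: Case 1: $\beta_h=x\beta_{h-1}+2+x+2x^2$, $\gamma_h=x^2\beta_{h-1}+2+2x+x^2$, $\delta_h=x^2\beta_{h-1}+1+2x+x^2+x^3$; Case 2: $\beta_h=x^2\beta_{h-1}+2+2x+x^2$, $\gamma_h=x^2\gamma_{h-1}+2+2x+x^2$,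 $\delta_h=x^2\delta_{h-1}+1+2x+x^2+x^3$; Case 3: $\beta_h=x^2\gamma_{h-1}+2+2x+x^2$, $\gamma_h=x\gamma_{h-1}+2+x+2x^2$, $\delta_h=x^2\gamma_{h-1}+1+2x+x^2+x^3$.
   Context: A benzenoid chain with $1$ hexagon is the $6$-cycle; a benzenoid chain with $h>1$ hexagons is obtained from one with $h-1$ hexagons by attaching a new hexagon (6-cycle) along an edge of the $(h-1)$st hexagon whose end-vertices have degree $2$. For a connected graph $G$, the distance between edges is their distance in the line graph $L(G)$, and the distance between a vertex $w$ and an edge $e=uv$ is $\min\{d(w,u),d(w,v)\}$. $H_e(G,x)=\sum_{k\ge0}d(G,k)x^k$ where $d(G,k)$ is the number of unordered pairs of (not necessarily distinct) edges at distance $k$; $H_e(G,w,x)=\sum_{k\ge0}d(G,w,k)x^k$ where $d(G,w,k)$ is the number of edges at distance $k$ from vertex $w$; $H_e(G,e,x)=\sum_{k\ge0}d(G,e,k)x^k$ where $d(G,e,k)$ is the number of edges at distance $k$ from edge $e$. -}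

module Defs where

open import Data.Nat using (ℕ; zero; suc; _+_; _*_; _∸_; _≡ᵇ_)
open import Data.Bool using (Bool; true; false; _∧_; _∨_; not)
open import Data.List using (List; []; _∷_; _++_; map; length; filterᵇ)
open import Data.Bool.ListAction using (any)
open import Data.Product using (_×_; _,_; proj₁; proj₂)
open import Relation.Binary.PropositionalEquality using (_≡_)

-- Finite graphs as lists of edges on vertices labelled by ℕ.
-- (Vertex set = set of endpoints; all graphs below are connected.)

Edge : Set
Edge = ℕ × ℕ

Graph : Set
Graph = List Edge

sameE : Edge → Edge → Bool
sameE (a , b) (c , d) = ((a ≡ᵇ c) ∧ (b ≡ᵇ d)) ∨ ((a ≡ᵇ d) ∧ (b ≡ᵇ c))

incident : ℕ → Edge → Bool
incident w (a , b) = (w ≡ᵇ a) ∨ (w ≡ᵇ b)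

-- two edges share an end-vertex (adjacency in the line graph L(G),
-- up to the reflexive case, which does not affect distances)
shareV : Edge → Edge → Bool
shareV (a , b) f = incident a f ∨ incident b f

withinV : Graph → ℕ → ℕ → ℕ → Bool
withinV G zero    u v = u ≡ᵇ v
withinV G (suc k) u v =
  (u ≡ᵇ v) ∨ any (λ e → ((proj₁ e ≡ᵇ u) ∧ withinV G k (proj₂ e) v)
                        ∨ ((proj₂ e ≡ᵇ u) ∧ withinV G k (proj₁ e) v)) G

withinE : Graph → ℕ → Edge → Edge → Bool
withinE G zero    e f = sameE e f
withinE G (suc k) e f = sameE e f ∨ any (λ g → shareV e g ∧ withinE G k g f) G

exactly : (ℕ → Bool) → ℕ → Bool
exactly le zero    = le zero
exactly le (suc k) = le (suc k) ∧ not (le k)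

count : {A : Set} → (A → Bool) → List A → ℕ
count p xs = length (filterᵇ p xs)

-- unordered pairs of (not necessarily distinct) list entries
upairs : {A : Set} → List A → List (A × A)
upairs []       = []
upairs (x ∷ xs) = (x , x) ∷ map (λ y → (x , y)) xs ++ upairs xs

-- Polynomials in x with ℕ coefficients, as coefficient sequences.

Poly : Set
Poly = ℕ → ℕ

_⊕_ : Poly → Poly → Poly
(p ⊕ q) k = p k + q k
infixl 6 _⊕_

X* : Poly → Poly
X* p zero    = 0
X* p (suc k) = p k

-- the polynomial a₀ + a₁x + a₂x² + ... given by its coefficient list
cst : List ℕ → Poly
cst []       k       = 0
cst (a ∷ as) zero    = a
cst (a ∷ as) (suc k) = cst as k

_≈ₚ_ : Poly → Poly → Set
p ≈ₚ q = ∀ k → p k ≡ q k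
infix 4 _≈ₚ_

-- H_e(G,x): coefficient k = # unordered pairs of edges at distance k in L(G)
HeG : Graph → Poly
HeG G k = count (λ ef → exactly (λ j → withinE G j (proj₁ ef) (proj₂ ef)) k) (upairs G)

-- H_e(G,w,x): coefficient k = # edges uv with min{d(w,u),d(w,v)} = k
HeV : Graph → ℕ → Poly
HeV G w k = count (λ e → exactly (λ j → withinV G j w (proj₁ e) ∨ withinV G j w (proj₂ e)) k) G

HeE : Graph → Edge → Poly
HeE G e k = count (λ f → exactly (λ j → withinE G j e f) k) G

data Case : Set where
  case1 case2 case3 : Case

record Chain : Set where
  constructor chain
  field
    graph : Graph
    u     : ℕ
    v     : ℕ
open Chain public

-- Step 0 is the auxiliary single edge u₀v₀ (vertices 0,1), so that step 1
-- yields the 6-cycle u₀ p q r s v₀ u₀.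
B : (ℕ → Case) → ℕ → Chain
B cs zero    = chain ((0 , 1) ∷ []) 0 1
B cs (suc h) = chain (graph prev ++ ((u prev , p) ∷ (p , q) ∷ (q , r) ∷ (r , s) ∷ (s , v prev) ∷ []))
                     (newU (cs (suc h))) (newV (cs (suc h)))
  where
  prev = B cs h
  p = 2 + 4 * h
  q = 3 + 4 * h
  r = 4 + 4 * h
  s = 5 + 4 * h
  newU : Case → ℕ
  newU case1 = p
  newU case2 = q
  newU case3 = r
  newV : Case → ℕ
  newV case1 = q
  newV case2 = r
  newV case3 = s

α β γ δ : (ℕ → Case) → ℕ → Poly
α cs zero    = cst (1 ∷ [])
α cs (suc h) = HeG (graph (B cs (suc h)))
β cs zero    = cst (1 ∷ [])
β cs (suc h) = HeV (graph (B cs (suc h))) (u (B cs (suc h)))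
γ cs zero    = cst (1 ∷ [])
γ cs (suc h) = HeV (graph (B cs (suc h))) (v (B cs (suc h)))
δ cs zero    = cst (1 ∷ [])
δ cs (suc h) = HeE (graph (B cs (suc h))) (u (B cs (suc h)) , v (B cs (suc h)))

-- Annelating a hexagon u p q r s v over the edge uv changes no distance between old vertices, and a
-- new vertex reaches the old graph only through u or v: p and q lie at distance 1 and 2 from u, r and s
-- at distance 2 and 1 from v, and going round through the edge uv never helps. Hence the old edges
-- contribute to H_e(B_h, w) and H_e(B_h, e) a copy of β or γ shifted by x or x². The one irregularity
-- is that qr lies at distance 3 from uv instead of 2 + d(uv, uv) = 2; this is where the x³ in δ
-- (Case 2) and in α comes from. Everything else happens inside the new 6-cycle and is computed by
-- evaluation. Finally H_e(B_h) counts the old pairs (α), the pairs of an old and a new edge (the old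
-- parts of the polynomials of the five new edges) and the pairs of new edges.

module Submission where

open import Defs
open import Data.Bool using (Bool; true; false; _∧_; _∨_; T; if_then_else_)
open import Data.Bool.Properties using (∨-comm; ∨-assoc) renaming (_≟_ to _≟ᴮ_)
open import Data.Empty using (⊥; ⊥-elim)
open import Data.Fin using (Fin; toℕ)
open import Data.Fin.Properties using (toℕ-injective; toℕ<n; all?)
open import Data.List using (List; []; _∷_; _++_; map)
open import Data.List.Membership.Propositional using (_∈_; find; lose)
open import Data.List.Membership.Propositional.Properties using (∈-++⁺ˡ; ∈-++⁺ʳ; ∈-++⁻; ∈-map⁺; ∈-map⁻)
open import Data.List.Properties using (map-++; map-∘; map-cong-local)
import Data.List.Relation.Unary.All as All
open import Data.List.Relation.Unary.Any using (here; there)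
open import Data.List.Relation.Unary.Any.Properties using (any⁺; any⁻)
open import Data.Nat
  using (ℕ; zero; suc; _+_; _∸_; _*_; _<_; _≤_; _≡ᵇ_; _≤ᵇ_; _<ᵇ_; _⊓_; ∣_-_∣; s≤s; s≤s⁻¹; z<s; s<s)
open import Data.Nat.ListAction using (sum)
open import Data.Nat.Properties
  using (_≟_; ≡ᵇ⇒≡; ≡⇒≡ᵇ; <⇒<ᵇ; <ᵇ⇒<; ≤⇒≤ᵇ; ≤ᵇ⇒≤; +-assoc; +-cancelʳ-≡; *-suc; suc-injective;
         m+n∸n≡m; n∸n≡0; n<1+n; m<n+m; m≤n+m; <-≤-trans; ≤-trans; <⇒≱; <⇒≢; ⊓-sel; m⊓n≤m; m⊓n≤n)
open import Data.Nat.Tactic.RingSolver using (solve-∀)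
open import Data.Product using (_×_; _,_; proj₁; proj₂; ∃-syntax)
open import Data.Sum using (_⊎_; inj₁; inj₂)
open import Function using (_∘_)
open import Relation.Binary.PropositionalEquality
open import Relation.Nullary using (¬_)
open import Relation.Nullary.Decidable using (toWitness)

T-ext : ∀ {a b} → (T a → T b) → (T b → T a) → a ≡ b
T-ext {false} {false} _ _ = refl
T-ext {false} {true}  _ g = ⊥-elim (g _)
T-ext {true}  {false} f _ = ⊥-elim (f _)
T-ext {true}  {true}  _ _ = refl

T⇒≡true : ∀ {a} → T a → a ≡ true
T⇒≡true {true} _ = refl

≡true⇒T : ∀ {a} → a ≡ true → T a
≡true⇒T refl = _

¬T⇒≡false : ∀ {a} → ¬ T a → a ≡ false
¬T⇒≡false {false} _ = refl
¬T⇒≡false {true}  h = ⊥-elim (h _)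

T-∨⁺ˡ : ∀ {a} b → T a → T (a ∨ b)
T-∨⁺ˡ {true} _ _ = _

T-∨⁺ʳ : ∀ a {b} → T b → T (a ∨ b)
T-∨⁺ʳ true  _ = _
T-∨⁺ʳ false p = p

T-∨⁻ : ∀ a {b} → T (a ∨ b) → T a ⊎ T b
T-∨⁻ true  p = inj₁ p
T-∨⁻ false p = inj₂ p

T-∧⁺ : ∀ {a b} → T a → T b → T (a ∧ b)
T-∧⁺ {true} _ p = p

T-∧⁻ : ∀ a {b} → T (a ∧ b) → T a × T b
T-∧⁻ true p = _ , p

≡ᵇ-refl : ∀ n → T (n ≡ᵇ n)
≡ᵇ-refl n = ≡⇒≡ᵇ n n refl

⊓-≤ᵇ : ∀ m n k → (m ⊓ n ≤ᵇ k) ≡ (m ≤ᵇ k) ∨ (n ≤ᵇ k)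
⊓-≤ᵇ m n k = T-ext to from
  where
  to : T (m ⊓ n ≤ᵇ k) → T ((m ≤ᵇ k) ∨ (n ≤ᵇ k))
  to h with ⊓-sel m n
  ... | inj₁ eq = T-∨⁺ˡ _ (≤⇒≤ᵇ (subst (_≤ k) eq (≤ᵇ⇒≤ _ k h)))
  ... | inj₂ eq = T-∨⁺ʳ (m ≤ᵇ k) (≤⇒≤ᵇ (subst (_≤ k) eq (≤ᵇ⇒≤ _ k h)))
  from : T ((m ≤ᵇ k) ∨ (n ≤ᵇ k)) → T (m ⊓ n ≤ᵇ k)
  from h with T-∨⁻ (m ≤ᵇ k) h
  ... | inj₁ p = ≤⇒≤ᵇ (≤-trans (m⊓n≤m m n) (≤ᵇ⇒≤ m k p))
  ... | inj₂ p = ≤⇒≤ᵇ (≤-trans (m⊓n≤n m n) (≤ᵇ⇒≤ n k p))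

suc-≤ᵇ : ∀ m k → (suc m ≤ᵇ suc k) ≡ (m ≤ᵇ k)
suc-≤ᵇ m k = T-ext (λ h → ≤⇒≤ᵇ (s≤s⁻¹ (≤ᵇ⇒≤ (suc m) (suc k) h)))
                   (λ h → ≤⇒≤ᵇ (s≤s (≤ᵇ⇒≤ m k h)))

∨-absorbʳ : ∀ a {b} → (T b → T a) → a ∨ b ≡ a
∨-absorbʳ true          _ = refl
∨-absorbʳ false {false} _ = refl
∨-absorbʳ false {true}  h = ⊥-elim (h _)

∨-absorbˡ : ∀ a {b} → (T b → T a) → b ∨ a ≡ a
∨-absorbˡ a {b} h = trans (∨-comm b a) (∨-absorbʳ a h)

∨-absorb₂ʳ : ∀ a b {c d} → (T c → T a) → (T d → T b) → a ∨ b ∨ c ∨ d ≡ a ∨ b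
∨-absorb₂ʳ true  b     _ _ = refl
∨-absorb₂ʳ false true  _ _ = refl
∨-absorb₂ʳ false false {false} {false} _ _ = refl
∨-absorb₂ʳ false false {true}          f _ = ⊥-elim (f _)
∨-absorb₂ʳ false false {false} {true}  _ g = ⊥-elim (g _)

∨-absorb₂ˡ : ∀ a b {c d} → (T c → T a) → (T d → T b) → c ∨ d ∨ a ∨ b ≡ a ∨ b
∨-absorb₂ˡ a b {c} {d} f g = begin
  c ∨ d ∨ a ∨ b     ≡⟨ sym (∨-assoc c d (a ∨ b)) ⟩
  (c ∨ d) ∨ a ∨ b   ≡⟨ ∨-comm (c ∨ d) (a ∨ b) ⟩
  (a ∨ b) ∨ c ∨ d   ≡⟨ ∨-assoc a b (c ∨ d) ⟩
  a ∨ b ∨ c ∨ d     ≡⟨ ∨-absorb₂ʳ a b f g ⟩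
  a ∨ b             ∎
  where open ≡-Reasoning

-- if le j says that d ≤ j, then shift le j says that d + 1 ≤ j
shift : (ℕ → Bool) → ℕ → Bool
shift le zero    = false
shift le (suc j) = le j

shift-cong : ∀ {f g} → (∀ j → f j ≡ g j) → ∀ j → shift f j ≡ shift g j
shift-cong f≡g zero    = refl
shift-cong f≡g (suc j) = f≡g j

shift-∨ : ∀ f g j → shift f j ∨ shift g j ≡ shift (λ j → f j ∨ g j) j
shift-∨ f g zero    = refl
shift-∨ f g (suc j) = refl

shift²-∨ : ∀ f g j → shift (shift f) j ∨ shift (shift g) j ≡ shift (shift (λ j → f j ∨ g j)) j
shift²-∨ f g j = trans (shift-∨ (shift f) (shift g) j) (shift-cong (shift-∨ f g) j)

Monotone : (ℕ → Bool) → Set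
Monotone f = ∀ m → T (f m) → T (f (suc m))

shift-≤ : ∀ {f} → Monotone f → ∀ k → T (shift f k) → T (f k)
shift-≤ mono (suc k) h = mono k h

shift-monotone : ∀ {f} → Monotone f → Monotone (shift f)
shift-monotone mono (suc m) h = mono m h

shift-preserves-≤ : ∀ {f g} → (∀ k → T (f k) → T (g k)) → ∀ k → T (shift f k) → T (shift g k)
shift-preserves-≤ f≤g (suc k) = f≤g k

exactly-cong : ∀ {le le'} → (∀ j → le j ≡ le' j) → ∀ k → exactly le k ≡ exactly le' k
exactly-cong h zero    = h 0
exactly-cong h (suc k) rewrite h (suc k) | h k = refl

exactly-shift : ∀ le k → exactly (shift le) (suc k) ≡ exactly le k
exactly-shift le zero with le 0
... | true  = refl
... | false = refl
exactly-shift le (suc k) = refl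

Adj : Graph → ℕ → ℕ → Set
Adj G a c = (a , c) ∈ G ⊎ (c , a) ∈ G

Adj-sym : ∀ {G a c} → Adj G a c → Adj G c a
Adj-sym (inj₁ m) = inj₂ m
Adj-sym (inj₂ m) = inj₁ m

module _ (G : Graph) where

  withinV-step⁻ : ∀ k a b → T (withinV G (suc k) a b) →
                  a ≡ b ⊎ ∃[ c ] Adj G a c × T (withinV G k c b)
  withinV-step⁻ k a b h with T-∨⁻ (a ≡ᵇ b) h
  ... | inj₁ a≡b = inj₁ (≡ᵇ⇒≡ a b a≡b)
  ... | inj₂ p with find (any⁻ _ G p)
  ... | (c , d) , cd∈G , q with T-∨⁻ ((c ≡ᵇ a) ∧ withinV G k d b) q
  ... | inj₁ q₁ = let c≡a , w = T-∧⁻ (c ≡ᵇ a) q₁ in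
                  inj₂ (d , inj₁ (subst (λ x → (x , d) ∈ G) (≡ᵇ⇒≡ c a c≡a) cd∈G) , w)
  ... | inj₂ q₂ = let d≡a , w = T-∧⁻ (d ≡ᵇ a) q₂ in
                  inj₂ (c , inj₂ (subst (λ x → (c , x) ∈ G) (≡ᵇ⇒≡ d a d≡a) cd∈G) , w)

  withinV-step⁺ : ∀ k a b → a ≡ b ⊎ ∃[ c ] Adj G a c × T (withinV G k c b) →
                  T (withinV G (suc k) a b)
  withinV-step⁺ k a b (inj₁ a≡b) = T-∨⁺ˡ _ (≡⇒≡ᵇ a b a≡b)
  withinV-step⁺ k a b (inj₂ (c , inj₁ ac∈G , w)) =
    T-∨⁺ʳ (a ≡ᵇ b) (any⁺ _ (lose ac∈G (T-∨⁺ˡ _ (T-∧⁺ (≡ᵇ-refl a) w))))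
  withinV-step⁺ k a b (inj₂ (c , inj₂ ca∈G , w)) =
    T-∨⁺ʳ (a ≡ᵇ b) (any⁺ _ (lose ca∈G (T-∨⁺ʳ ((c ≡ᵇ a) ∧ _) (T-∧⁺ (≡ᵇ-refl a) w))))

  withinV-refl : ∀ k a → T (withinV G k a a)
  withinV-refl zero    a = ≡ᵇ-refl a
  withinV-refl (suc k) a = withinV-step⁺ k a a (inj₁ refl)

  withinV-suc : ∀ k a b → T (withinV G k a b) → T (withinV G (suc k) a b)
  withinV-suc zero a b h = withinV-step⁺ 0 a b (inj₁ (≡ᵇ⇒≡ a b h))
  withinV-suc (suc k) a b h with withinV-step⁻ k a b h
  ... | inj₁ a≡b          = withinV-step⁺ (suc k) a b (inj₁ a≡b)
  ... | inj₂ (c , ac , w) = withinV-step⁺ (suc k) a b (inj₂ (c , ac , withinV-suc k c b w))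

  withinV-snoc : ∀ k a c b → T (withinV G k a c) → Adj G c b → T (withinV G (suc k) a b)
  withinV-snoc zero a c b h cb
    with refl ← ≡ᵇ⇒≡ a c h = withinV-step⁺ 0 a b (inj₂ (b , cb , ≡ᵇ-refl b))
  withinV-snoc (suc k) a c b h cb with withinV-step⁻ k a c h
  ... | inj₁ refl         = withinV-suc (suc k) a b (withinV-snoc k a a b (withinV-refl k a) cb)
  ... | inj₂ (d , ad , w) = withinV-step⁺ (suc k) a b (inj₂ (d , ad , withinV-snoc k d c b w cb))

  withinV-sym : ∀ k a b → T (withinV G k a b) → T (withinV G k b a)
  withinV-sym zero a b h = ≡⇒≡ᵇ b a (sym (≡ᵇ⇒≡ a b h))
  withinV-sym (suc k) a b h with withinV-step⁻ k a b h
  ... | inj₁ refl         = withinV-refl (suc k) a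
  ... | inj₂ (c , ac , w) = withinV-snoc k b c a (withinV-sym k c b w) (Adj-sym ac)

  withinV-comm : ∀ k a b → withinV G k a b ≡ withinV G k b a
  withinV-comm k a b = T-ext (withinV-sym k a b) (withinV-sym k b a)

withinV-⊆ : ∀ {G H} → (∀ {e} → e ∈ G → e ∈ H) → ∀ k a b →
            T (withinV G k a b) → T (withinV H k a b)
withinV-⊆ G⊆H zero a b h = h
withinV-⊆ {G} {H} G⊆H (suc k) a b h with withinV-step⁻ G k a b h
... | inj₁ a≡b              = withinV-step⁺ H k a b (inj₁ a≡b)
... | inj₂ (c , inj₁ m , w) = withinV-step⁺ H k a b (inj₂ (c , inj₁ (G⊆H m) , withinV-⊆ G⊆H k c b w))
... | inj₂ (c , inj₂ m , w) = withinV-step⁺ H k a b (inj₂ (c , inj₂ (G⊆H m) , withinV-⊆ G⊆H k c b w))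

IsEnd : ℕ → Edge → Set
IsEnd x e = x ≡ proj₁ e ⊎ x ≡ proj₂ e

sameE⁻ : ∀ a b c d → T (sameE (a , b) (c , d)) → (a ≡ c × b ≡ d) ⊎ (a ≡ d × b ≡ c)
sameE⁻ a b c d h with T-∨⁻ ((a ≡ᵇ c) ∧ (b ≡ᵇ d)) h
... | inj₁ p = let x , y = T-∧⁻ (a ≡ᵇ c) p in inj₁ (≡ᵇ⇒≡ a c x , ≡ᵇ⇒≡ b d y)
... | inj₂ p = let x , y = T-∧⁻ (a ≡ᵇ d) p in inj₂ (≡ᵇ⇒≡ a d x , ≡ᵇ⇒≡ b c y)

sameE⁺ : ∀ a b c d → (a ≡ c × b ≡ d) ⊎ (a ≡ d × b ≡ c) → T (sameE (a , b) (c , d))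
sameE⁺ a b c d (inj₁ (refl , refl)) = T-∨⁺ˡ _ (T-∧⁺ (≡ᵇ-refl a) (≡ᵇ-refl b))
sameE⁺ a b c d (inj₂ (refl , refl)) = T-∨⁺ʳ ((a ≡ᵇ b) ∧ (b ≡ᵇ a)) (T-∧⁺ (≡ᵇ-refl a) (≡ᵇ-refl b))

sameE-refl : ∀ e → T (sameE e e)
sameE-refl (a , b) = sameE⁺ a b a b (inj₁ (refl , refl))

sameE-comm : ∀ e f → sameE e f ≡ sameE f e
sameE-comm (a , b) (c , d) = T-ext (λ h → sameE⁺ c d a b (flip (sameE⁻ a b c d h)))
                                   (λ h → sameE⁺ a b c d (flip (sameE⁻ c d a b h)))
  where
  flip : ∀ {a b c d : ℕ} → (a ≡ c × b ≡ d) ⊎ (a ≡ d × b ≡ c) → (c ≡ a × d ≡ b) ⊎ (c ≡ b × d ≡ a)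
  flip (inj₁ (x , y)) = inj₁ (sym x , sym y)
  flip (inj₂ (x , y)) = inj₂ (sym y , sym x)

sameE-IsEnd : ∀ e f z → T (sameE e f) → IsEnd z e → IsEnd z f
sameE-IsEnd (a , b) (c , d) z h z∈e with sameE⁻ a b c d h | z∈e
... | inj₁ (x , _) | inj₁ refl = inj₁ x
... | inj₁ (_ , y) | inj₂ refl = inj₂ y
... | inj₂ (x , _) | inj₁ refl = inj₂ x
... | inj₂ (_ , y) | inj₂ refl = inj₁ y

incident⁻ : ∀ w e → T (incident w e) → IsEnd w e
incident⁻ w (c , d) h with T-∨⁻ (w ≡ᵇ c) h
... | inj₁ p = inj₁ (≡ᵇ⇒≡ w c p)
... | inj₂ p = inj₂ (≡ᵇ⇒≡ w d p)

incident⁺ : ∀ w e → IsEnd w e → T (incident w e)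
incident⁺ w (c , d) (inj₁ p) = T-∨⁺ˡ _ (≡⇒≡ᵇ w c p)
incident⁺ w (c , d) (inj₂ p) = T-∨⁺ʳ (w ≡ᵇ c) (≡⇒≡ᵇ w d p)

shareV⁻ : ∀ e g → T (shareV e g) → ∃[ x ] IsEnd x e × IsEnd x g
shareV⁻ (a , b) g h with T-∨⁻ (incident a g) h
... | inj₁ p = a , inj₁ refl , incident⁻ a g p
... | inj₂ p = b , inj₂ refl , incident⁻ b g p

shareV⁺ : ∀ x e g → IsEnd x e → IsEnd x g → T (shareV e g)
shareV⁺ x (a , b) g (inj₁ refl) i = T-∨⁺ˡ _ (incident⁺ x g i)
shareV⁺ x (a , b) g (inj₂ refl) i = T-∨⁺ʳ (incident a g) (incident⁺ x g i)

IsEnd-Adj : ∀ {G g z z'} → g ∈ G → IsEnd z g → IsEnd z' g → z ≡ z' ⊎ Adj G z z'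
IsEnd-Adj m (inj₁ refl) (inj₁ refl) = inj₁ refl
IsEnd-Adj m (inj₂ refl) (inj₂ refl) = inj₁ refl
IsEnd-Adj m (inj₁ refl) (inj₂ refl) = inj₂ (inj₁ m)
IsEnd-Adj m (inj₂ refl) (inj₁ refl) = inj₂ (inj₂ m)

endsWithin : Graph → ℕ → Edge → Edge → Bool
endsWithin G k (a , b) (c , d) =
  withinV G k a c ∨ withinV G k a d ∨ withinV G k b c ∨ withinV G k b d

module _ (G : Graph) where

  withinE-step⁻ : ∀ k e f → T (withinE G (suc k) e f) →
                  T (sameE e f) ⊎ ∃[ g ] g ∈ G × T (shareV e g) × T (withinE G k g f)
  withinE-step⁻ k e f h with T-∨⁻ (sameE e f) h
  ... | inj₁ p = inj₁ p
  ... | inj₂ p with find (any⁻ _ G p)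
  ... | g , g∈G , q = let s , w = T-∧⁻ (shareV e g) q in inj₂ (g , g∈G , s , w)

  withinE-step⁺ : ∀ k e f g → g ∈ G → T (shareV e g) → T (withinE G k g f) → T (withinE G (suc k) e f)
  withinE-step⁺ k e f g g∈G s w = T-∨⁺ʳ (sameE e f) (any⁺ _ (lose g∈G (T-∧⁺ s w)))

  withinE-suc : ∀ k e f → T (withinE G k e f) → T (withinE G (suc k) e f)
  withinE-suc zero e f h = T-∨⁺ˡ _ h
  withinE-suc (suc k) e f h with withinE-step⁻ k e f h
  ... | inj₁ p                = T-∨⁺ˡ _ p
  ... | inj₂ (g , g∈G , s , w) = withinE-step⁺ (suc k) e f g g∈G s (withinE-suc k g f w)

  withinE-same : ∀ k e f → T (sameE e f) → T (withinE G k e f)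
  withinE-same zero    e f p = p
  withinE-same (suc k) e f p = T-∨⁺ˡ _ p

  withinE⇒withinV : ∀ k g f → g ∈ G → T (withinE G k g f) →
                    ∀ z → IsEnd z g → ∃[ y ] IsEnd y f × T (withinV G k z y)
  withinE⇒withinV zero g f _ h z z∈g = z , sameE-IsEnd g f z h z∈g , withinV-refl G 0 z
  withinE⇒withinV (suc k) g f g∈G h z z∈g with withinE-step⁻ k g f h
  ... | inj₁ p = z , sameE-IsEnd g f z p z∈g , withinV-refl G (suc k) z
  ... | inj₂ (g' , g'∈G , s , w) with shareV⁻ g g' s
  ... | z' , z'∈g , z'∈g' with withinE⇒withinV k g' f g'∈G w z' z'∈g' | IsEnd-Adj g∈G z∈g z'∈g
  ... | y , y∈f , zy | inj₁ refl = y , y∈f , withinV-suc G k z y zy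
  ... | y , y∈f , zy | inj₂ zz'  = y , y∈f , withinV-step⁺ G k z y (inj₂ (z' , zz' , zy))

  withinV⇒withinE : ∀ k x y e f → IsEnd x e → f ∈ G → IsEnd y f →
                    T (withinV G k x y) → T (withinE G (suc k) e f)
  withinV⇒withinE zero x y e f x∈e f∈G y∈f h with refl ← ≡ᵇ⇒≡ x y h =
    withinE-step⁺ 0 e f f f∈G (shareV⁺ x e f x∈e y∈f) (sameE-refl f)
  withinV⇒withinE (suc k) x y e f x∈e f∈G y∈f h with withinV-step⁻ G k x y h
  ... | inj₁ refl = withinE-suc (suc k) e f (withinV⇒withinE k x x e f x∈e f∈G y∈f (withinV-refl G k x))
  ... | inj₂ (c , inj₁ xc∈G , w) = withinE-step⁺ (suc k) e f (x , c) xc∈G (shareV⁺ x e _ x∈e (inj₁ refl))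
                                     (withinV⇒withinE k c y (x , c) f (inj₂ refl) f∈G y∈f w)
  ... | inj₂ (c , inj₂ cx∈G , w) = withinE-step⁺ (suc k) e f (c , x) cx∈G (shareV⁺ x e _ x∈e (inj₂ refl))
                                     (withinV⇒withinE k c y (c , x) f (inj₁ refl) f∈G y∈f w)

  endsWithin⁻ : ∀ k a b c d → T (endsWithin G k (a , b) (c , d)) →
                ∃[ x ] ∃[ y ] IsEnd x (a , b) × IsEnd y (c , d) × T (withinV G k x y)
  endsWithin⁻ k a b c d h with T-∨⁻ (withinV G k a c) h
  ... | inj₁ p = a , c , inj₁ refl , inj₁ refl , p
  ... | inj₂ h₂ with T-∨⁻ (withinV G k a d) h₂
  ... | inj₁ p = a , d , inj₁ refl , inj₂ refl , p
  ... | inj₂ h₃ with T-∨⁻ (withinV G k b c) h₃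
  ... | inj₁ p = b , c , inj₂ refl , inj₁ refl , p
  ... | inj₂ p = b , d , inj₂ refl , inj₂ refl , p

  endsWithin⁺ : ∀ k a b c d x y → IsEnd x (a , b) → IsEnd y (c , d) →
                T (withinV G k x y) → T (endsWithin G k (a , b) (c , d))
  endsWithin⁺ k a b c d x y (inj₁ refl) (inj₁ refl) h = T-∨⁺ˡ _ h
  endsWithin⁺ k a b c d x y (inj₁ refl) (inj₂ refl) h = T-∨⁺ʳ (withinV G k a c) (T-∨⁺ˡ _ h)
  endsWithin⁺ k a b c d x y (inj₂ refl) (inj₁ refl) h =
    T-∨⁺ʳ (withinV G k a c) (T-∨⁺ʳ (withinV G k a d) (T-∨⁺ˡ _ h))
  endsWithin⁺ k a b c d x y (inj₂ refl) (inj₂ refl) h =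
    T-∨⁺ʳ (withinV G k a c) (T-∨⁺ʳ (withinV G k a d) (T-∨⁺ʳ (withinV G k b c) h))

  withinE-unfold : ∀ k e f → f ∈ G → withinE G (suc k) e f ≡ sameE e f ∨ endsWithin G k e f
  withinE-unfold k (a , b) (c , d) f∈G = T-ext to from
    where
    to : T (withinE G (suc k) (a , b) (c , d)) → T (sameE (a , b) (c , d) ∨ endsWithin G k (a , b) (c , d))
    to h with withinE-step⁻ k (a , b) (c , d) h
    ... | inj₁ p = T-∨⁺ˡ _ p
    ... | inj₂ (g , g∈G , s , w) with shareV⁻ (a , b) g s
    ... | x , x∈e , x∈g with withinE⇒withinV k g (c , d) g∈G w x x∈g
    ... | y , y∈f , xy = T-∨⁺ʳ (sameE (a , b) (c , d)) (endsWithin⁺ k a b c d x y x∈e y∈f xy)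
    from : T (sameE (a , b) (c , d) ∨ endsWithin G k (a , b) (c , d)) → T (withinE G (suc k) (a , b) (c , d))
    from h with T-∨⁻ (sameE (a , b) (c , d)) h
    ... | inj₁ p = T-∨⁺ˡ _ p
    ... | inj₂ p with endsWithin⁻ k a b c d p
    ... | x , y , x∈e , y∈f , xy = withinV⇒withinE k x y (a , b) (c , d) x∈e f∈G y∈f xy

  endsWithin-comm : ∀ k e f → endsWithin G k e f ≡ endsWithin G k f e
  endsWithin-comm k (a , b) (c , d)
    rewrite withinV-comm G k c a | withinV-comm G k c b | withinV-comm G k d a | withinV-comm G k d b =
    swap-middle (withinV G k a c) (withinV G k a d) (withinV G k b c) (withinV G k b d)
    where
    swap-middle : ∀ x y z w → x ∨ y ∨ z ∨ w ≡ x ∨ z ∨ y ∨ w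
    swap-middle true  y     z     w = refl
    swap-middle false true  true  w = refl
    swap-middle false true  false w = refl
    swap-middle false false z     w = refl

  withinE-comm : ∀ e f → e ∈ G → f ∈ G → ∀ k → withinE G k e f ≡ withinE G k f e
  withinE-comm e f e∈G f∈G zero = sameE-comm e f
  withinE-comm e f e∈G f∈G (suc k)
    rewrite withinE-unfold k e f f∈G | withinE-unfold k f e e∈G | sameE-comm e f | endsWithin-comm k e f = refl

  withinE-distinct : ∀ {e f} → f ∈ G → sameE e f ≡ false →
                     ∀ j → shift (λ m → endsWithin G m e f) j ≡ withinE G j e f
  withinE-distinct {e} {f} f∈G e≢f zero    = sym e≢f
  withinE-distinct {e} {f} f∈G e≢f (suc m) rewrite withinE-unfold m e f f∈G | e≢f = refl

𝟙 : Bool → ℕ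
𝟙 true  = 1
𝟙 false = 0

module _ {A : Set} where

  count-∷ : ∀ (p : A → Bool) x xs → count p (x ∷ xs) ≡ 𝟙 (p x) + count p xs
  count-∷ p x xs with p x
  ... | true  = refl
  ... | false = refl

  count-++ : ∀ (p : A → Bool) xs ys → count p (xs ++ ys) ≡ count p xs + count p ys
  count-++ p []       ys = refl
  count-++ p (x ∷ xs) ys
    rewrite count-∷ p x (xs ++ ys) | count-∷ p x xs | count-++ p xs ys = sym (+-assoc (𝟙 (p x)) _ _)

  count-cong : ∀ (p q : A → Bool) xs → (∀ x → x ∈ xs → p x ≡ q x) → count p xs ≡ count q xs
  count-cong p q []       _ = refl
  count-cong p q (x ∷ xs) h
    rewrite count-∷ p x xs | count-∷ q x xs | h x (here refl)
          | count-cong p q xs (λ y m → h y (there m)) = refl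

  count-false : ∀ (p : A → Bool) xs → (∀ x → x ∈ xs → p x ≡ false) → count p xs ≡ 0
  count-false p []       _ = refl
  count-false p (x ∷ xs) h rewrite count-∷ p x xs | h x (here refl) = count-false p xs (λ y m → h y (there m))

  count≡0⇒false : ∀ (p : A → Bool) xs → count p xs ≡ 0 → ∀ x → x ∈ xs → p x ≡ false
  count≡0⇒false p (y ∷ xs) h x m with p y in eq
  count≡0⇒false p (y ∷ xs) h x (here refl) | false = eq
  count≡0⇒false p (y ∷ xs) h x (there m)   | false = count≡0⇒false p xs h x m

  count-except-one : ∀ (p q s : A → Bool) a b xs → count s xs ≡ 1 →
    (∀ x → x ∈ xs → s x ≡ false → p x ≡ q x) → (∀ x → x ∈ xs → s x ≡ true → p x ≡ a × q x ≡ b) →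
    count p xs + 𝟙 b ≡ count q xs + 𝟙 a
  count-except-one p q s a b (x ∷ xs) one off on
    rewrite count-∷ p x xs | count-∷ q x xs | count-∷ s x xs with s x in eq
  ... | true rewrite proj₁ (on x (here refl) eq) | proj₂ (on x (here refl) eq)
        | count-cong p q xs (λ y m → off y (there m) (count≡0⇒false s xs (suc-injective one) y m)) =
        reverse (𝟙 a) (count q xs) (𝟙 b)
    where
    reverse : ∀ x y z → x + y + z ≡ z + y + x
    reverse = solve-∀
  ... | false rewrite off x (here refl) eq
        | +-assoc (𝟙 (q x)) (count p xs) (𝟙 b)
        | count-except-one p q s a b xs one (λ y m → off y (there m)) (λ y m → on y (there m)) =
        sym (+-assoc (𝟙 (q x)) (count q xs) (𝟙 a))

count-map : ∀ {A B : Set} (p : B → Bool) (f : A → B) xs → count p (map f xs) ≡ count (λ x → p (f x)) xs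
count-map p f []       = refl
count-map p f (x ∷ xs) rewrite count-∷ p (f x) (map f xs) | count-∷ (λ x → p (f x)) x xs | count-map p f xs = refl

module _ {A : Set} where

  upairs-∈ : ∀ {x y : A} xs → (x , y) ∈ upairs xs → x ∈ xs × y ∈ xs
  upairs-∈ (z ∷ xs) (here refl) = here refl , here refl
  upairs-∈ {x} {y} (z ∷ xs) (there m) with ∈-++⁻ (map (λ y → (z , y)) xs) m
  ... | inj₂ m' = let x∈ , y∈ = upairs-∈ xs m' in there x∈ , there y∈
  ... | inj₁ m' with ∈-map⁻ (λ y → (z , y)) m'
  ... | w , w∈xs , refl = here refl , there w∈xs

  sum-count-swap : ∀ (p : A → A → Bool) xs ys →
    sum (map (λ x → count (p x) ys) xs) ≡ sum (map (λ y → count (λ x → p x y) xs) ys)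
  sum-count-swap p xs []       = sum-zero xs
    where
    sum-zero : ∀ xs → sum (map (λ x → count (p x) []) xs) ≡ 0
    sum-zero []       = refl
    sum-zero (_ ∷ xs) = sum-zero xs
  sum-count-swap p xs (y ∷ ys) = trans (sum-count-∷ xs) (cong (count (λ x → p x y) xs +_) (sum-count-swap p xs ys))
    where
    sum-count-∷ : ∀ xs → sum (map (λ x → count (p x) (y ∷ ys)) xs) ≡
                         count (λ x → p x y) xs + sum (map (λ x → count (p x) ys) xs)
    sum-count-∷ []       = refl
    sum-count-∷ (x ∷ xs) rewrite count-∷ (p x) y ys | count-∷ (λ x → p x y) x xs | sum-count-∷ xs =
      interchange (𝟙 (p x y)) (count (p x) ys) (count (λ x → p x y) xs) (sum (map (λ x → count (p x) ys) xs))
      where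
      interchange : ∀ a b c d → a + b + (c + d) ≡ a + c + (b + d)
      interchange = solve-∀

  count-upairs-++ : ∀ (p : A × A → Bool) xs ys →
    count p (upairs (xs ++ ys)) ≡
    count p (upairs xs) + sum (map (λ x → count (λ y → p (x , y)) ys) xs) + count p (upairs ys)
  count-upairs-++ p []       ys = refl
  count-upairs-++ p (x ∷ xs) ys
    rewrite count-∷ p (x , x) (map (λ y → (x , y)) (xs ++ ys) ++ upairs (xs ++ ys))
          | count-∷ p (x , x) (map (λ y → (x , y)) xs ++ upairs xs)
          | count-++ p (map (λ y → (x , y)) (xs ++ ys)) (upairs (xs ++ ys))
          | count-++ p (map (λ y → (x , y)) xs) (upairs xs)
          | count-map p (λ y → (x , y)) (xs ++ ys)
          | count-map p (λ y → (x , y)) xs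
          | count-++ (λ y → p (x , y)) xs ys
          | count-upairs-++ p xs ys =
    regroup (𝟙 (p (x , x))) (count (λ y → p (x , y)) xs) (count (λ y → p (x , y)) ys) (count p (upairs xs))
            (sum (map (λ x → count (λ y → p (x , y)) ys) xs)) (count p (upairs ys))
    where
    regroup : ∀ a b c d e f → a + (b + c + (d + e + f)) ≡ a + (b + d) + (c + e) + f
    regroup = solve-∀

upairs-map : ∀ {A B : Set} (f : A → B) xs → upairs (map f xs) ≡ map (λ p → f (proj₁ p) , f (proj₂ p)) (upairs xs)
upairs-map f []       = refl
upairs-map f (x ∷ xs)
  rewrite upairs-map f xs | map-++ (λ p → f (proj₁ p) , f (proj₂ p)) (map (λ y → (x , y)) xs) (upairs xs)
  | sym (map-∘ {g = λ p → f (proj₁ p) , f (proj₂ p)} {f = λ y → (x , y)} xs)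
  | sym (map-∘ {g = λ y → (f x , y)} {f = f} xs) = refl

distPoly : {A : Set} → (A → ℕ → Bool) → List A → Poly
distPoly le xs k = count (λ x → exactly (le x) k) xs

module _ {A : Set} where

  distPoly-cong : ∀ {le le' : A → ℕ → Bool} xs → (∀ x → x ∈ xs → ∀ j → le x j ≡ le' x j) →
                  distPoly le xs ≈ₚ distPoly le' xs
  distPoly-cong xs h k = count-cong _ _ xs (λ x m → exactly-cong (h x m) k)

  distPoly-shift : ∀ (le : A → ℕ → Bool) xs → distPoly (λ x → shift (le x)) xs ≈ₚ X* (distPoly le xs)
  distPoly-shift le xs zero    = count-false _ xs (λ _ _ → refl)
  distPoly-shift le xs (suc k) = count-cong _ _ xs (λ x _ → exactly-shift (le x) k)

≈ₚ-sym : ∀ {p q} → p ≈ₚ q → q ≈ₚ p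
≈ₚ-sym p≈q k = sym (p≈q k)

≈ₚ-trans : ∀ {p q r} → p ≈ₚ q → q ≈ₚ r → p ≈ₚ r
≈ₚ-trans p≈q q≈r k = trans (p≈q k) (q≈r k)

⊕-cong : ∀ {p p' q q'} → p ≈ₚ p' → q ≈ₚ q' → p ⊕ q ≈ₚ p' ⊕ q'
⊕-cong p≈ q≈ k = cong₂ _+_ (p≈ k) (q≈ k)

X*-cong : ∀ {p q} → p ≈ₚ q → X* p ≈ₚ X* q
X*-cong p≈q zero    = refl
X*-cong p≈q (suc k) = p≈q k

X*-⊕ : ∀ p q → X* (p ⊕ q) ≈ₚ X* p ⊕ X* q
X*-⊕ p q zero    = refl
X*-⊕ p q (suc k) = refl

-- cancels corrections r, r' added on opposite sides, without subtracting in ℕ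
⊕-exchange : ∀ {p p' q q' r r'} → p ⊕ r ≈ₚ p' ⊕ r' → q ⊕ r' ≈ₚ q' ⊕ r → p ⊕ q ≈ₚ p' ⊕ q'
⊕-exchange {p} {p'} {q} {q'} {r} {r'} e₁ e₂ k = +-cancelʳ-≡ (r k) (p k + q k) (p' k + q' k) (begin
  p k + q k + r k     ≡⟨ swap (p k) (q k) (r k) ⟩
  p k + r k + q k     ≡⟨ cong (_+ q k) (e₁ k) ⟩
  p' k + r' k + q k   ≡⟨ rotate (p' k) (r' k) (q k) ⟩
  p' k + (q k + r' k) ≡⟨ cong (p' k +_) (e₂ k) ⟩
  p' k + (q' k + r k) ≡⟨ sym (+-assoc (p' k) (q' k) (r k)) ⟩
  p' k + q' k + r k   ∎)
  where
  open ≡-Reasoning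
  swap : ∀ a b c → a + b + c ≡ a + c + b
  swap = solve-∀
  rotate : ∀ a b c → a + b + c ≡ a + (c + b)
  rotate = solve-∀

agreeUpTo : ℕ → Poly → Poly → Bool
agreeUpTo zero    p q = true
agreeUpTo (suc n) p q = (p 0 ≡ᵇ q 0) ∧ agreeUpTo n (λ k → p (suc k)) (λ k → q (suc k))

≈ₚ-by-evaluation : ∀ n p q → T (agreeUpTo n p q) → (∀ k → p (n + k) ≡ q (n + k)) → p ≈ₚ q
≈ₚ-by-evaluation zero    p q _ tail k = tail k
≈ₚ-by-evaluation (suc n) p q h tail zero    = ≡ᵇ⇒≡ (p 0) (q 0) (proj₁ (T-∧⁻ (p 0 ≡ᵇ q 0) h))
≈ₚ-by-evaluation (suc n) p q h tail (suc k) =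
  ≈ₚ-by-evaluation n (λ k → p (suc k)) (λ k → q (suc k)) (proj₂ (T-∧⁻ (p 0 ≡ᵇ q 0) h)) tail k

always : ℕ → Bool
always _ = true

exactly-shift²-always : ∀ k → 𝟙 (exactly (shift (shift always)) k) ≡ cst (0 ∷ 0 ∷ 1 ∷ []) k
exactly-shift²-always = ≈ₚ-by-evaluation 3 _ _ _ (λ _ → refl)

exactly-shift³-always : ∀ k → 𝟙 (exactly (shift (shift (shift always))) k) ≡ cst (0 ∷ 0 ∷ 0 ∷ 1 ∷ []) k
exactly-shift³-always = ≈ₚ-by-evaluation 4 _ _ _ (λ _ → refl)

αStep : Poly → Poly → Poly → Poly → Poly
αStep a b g d = a ⊕ (X* (b ⊕ g) ⊕ X* (X* (b ⊕ g))) ⊕ X* (X* d) ⊕ cst (5 ∷ 4 ∷ 3 ∷ 3 ∷ [])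

αStep-cong : ∀ {a a' b b' g g' d d'} → a ≈ₚ a' → b ≈ₚ b' → g ≈ₚ g' → d ≈ₚ d' →
             αStep a b g d ≈ₚ αStep a' b' g' d'
αStep-cong a≈ b≈ g≈ d≈ =
  ⊕-cong (⊕-cong (⊕-cong a≈ (⊕-cong (X*-cong (⊕-cong b≈ g≈)) (X*-cong (X*-cong (⊕-cong b≈ g≈)))))
                 (X*-cong (X*-cong d≈)))
         (λ _ → refl)

-- The hexagon

pattern i0 = Fin.zero
pattern i1 = Fin.suc i0
pattern i2 = Fin.suc i1
pattern i3 = Fin.suc i2
pattern i4 = Fin.suc i3
pattern i5 = Fin.suc i4

hexPath : List (Fin 6 × Fin 6)
hexPath = (i0 , i1) ∷ (i1 , i2) ∷ (i2 , i3) ∷ (i3 , i4) ∷ (i4 , i5) ∷ []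

data New : Fin 6 → Set where
  new1 : New i1
  new2 : New i2
  new3 : New i3
  new4 : New i4

PathAdj : Fin 6 → Fin 6 → Set
PathAdj i j = (i , j) ∈ hexPath ⊎ (j , i) ∈ hexPath

hexPath-step : ∀ {i j} → (i , j) ∈ hexPath → toℕ j ≡ suc (toℕ i)
hexPath-step (here refl)                                 = refl
hexPath-step (there (here refl))                         = refl
hexPath-step (there (there (here refl)))                 = refl
hexPath-step (there (there (there (here refl))))         = refl
hexPath-step (there (there (there (there (here refl))))) = refl

PathAdj-u : ∀ {j} → PathAdj i0 j → j ≡ i1
PathAdj-u (inj₁ m) = toℕ-injective (hexPath-step m)
PathAdj-u (inj₂ m) with () ← hexPath-step m

PathAdj-v : ∀ {j} → PathAdj i5 j → j ≡ i4
PathAdj-v {j} (inj₁ m) = ⊥-elim (<⇒≢ (toℕ<n j) (hexPath-step m))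
PathAdj-v     (inj₂ m) = toℕ-injective (suc-injective (sym (hexPath-step m)))

data Interior : Fin 6 → Fin 6 → Fin 6 → Set where
  interior1 : Interior i1 i0 i2
  interior2 : Interior i2 i1 i3
  interior3 : Interior i3 i2 i4
  interior4 : Interior i4 i3 i5

Interior-new : ∀ {i a b} → Interior i a b → New i
Interior-new interior1 = new1
Interior-new interior2 = new2
Interior-new interior3 = new3
Interior-new interior4 = new4

Interior-adjˡ : ∀ {i a b} → Interior i a b → PathAdj i a
Interior-adjˡ interior1 = inj₂ (here refl)
Interior-adjˡ interior2 = inj₂ (there (here refl))
Interior-adjˡ interior3 = inj₂ (there (there (here refl)))
Interior-adjˡ interior4 = inj₂ (there (there (there (here refl))))

Interior-adjʳ : ∀ {i a b} → Interior i a b → PathAdj i b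
Interior-adjʳ interior1 = inj₁ (there (here refl))
Interior-adjʳ interior2 = inj₁ (there (there (here refl)))
Interior-adjʳ interior3 = inj₁ (there (there (there (here refl))))
Interior-adjʳ interior4 = inj₁ (there (there (there (there (here refl)))))

Interior-pred : ∀ {i a b} → Interior i a b → toℕ i ≡ suc (toℕ a)
Interior-pred interior1 = refl
Interior-pred interior2 = refl
Interior-pred interior3 = refl
Interior-pred interior4 = refl

Interior-succ : ∀ {i a b} → Interior i a b → toℕ b ≡ suc (toℕ i)
Interior-succ interior1 = refl
Interior-succ interior2 = refl
Interior-succ interior3 = refl
Interior-succ interior4 = refl

Interior-only : ∀ {i a b j} → Interior i a b → PathAdj i j → j ≡ a ⊎ j ≡ b
Interior-only int (inj₁ m) = inj₂ (toℕ-injective (trans (hexPath-step m) (sym (Interior-succ int))))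
Interior-only int (inj₂ m) = inj₁ (toℕ-injective (suc-injective (trans (sym (hexPath-step m)) (Interior-pred int))))

hexPath-new : ∀ {a b} → (a , b) ∈ hexPath → New a ⊎ New b
hexPath-new (here refl)                                 = inj₂ new1
hexPath-new (there (here refl))                         = inj₁ new1
hexPath-new (there (there (here refl)))                 = inj₁ new2
hexPath-new (there (there (there (here refl))))         = inj₁ new3
hexPath-new (there (there (there (there (here refl))))) = inj₁ new4

hexPath-once : ∀ {a b} → (a , b) ∈ hexPath →
               count (λ e → sameE (toℕ a , toℕ b) (toℕ (proj₁ e) , toℕ (proj₂ e))) hexPath ≡ 1
hexPath-once (here refl)                                 = refl
hexPath-once (there (here refl))                         = refl
hexPath-once (there (there (here refl)))                 = refl
hexPath-once (there (there (there (here refl))))         = refl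
hexPath-once (there (there (there (there (here refl))))) = refl

cycDist : Fin 6 → Fin 6 → ℕ
cycDist i j = ∣ toℕ i - toℕ j ∣ ⊓ (6 ∸ ∣ toℕ i - toℕ j ∣)

cycDist-comm : ∀ i j → cycDist i j ≡ cycDist j i
cycDist-comm = toWitness {a? = all? λ i → all? λ j → cycDist i j ≟ cycDist j i} _

cycDist-≤ᵇ0 : ∀ i j → (toℕ i ≡ᵇ toℕ j) ≡ (cycDist i j ≤ᵇ 0)
cycDist-≤ᵇ0 = toWitness {a? = all? λ i → all? λ j → (toℕ i ≡ᵇ toℕ j) ≟ᴮ (cycDist i j ≤ᵇ 0)} _

cycDist-interior : ∀ {i a b} → Interior i a b → ∀ j →
  cycDist i j ≡ (if toℕ i ≡ᵇ toℕ j then 0 else suc (cycDist a j ⊓ cycDist b j))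
cycDist-interior interior1 = toWitness {a? = all? λ _ → _ ≟ _} _
cycDist-interior interior2 = toWitness {a? = all? λ _ → _ ≟ _} _
cycDist-interior interior3 = toWitness {a? = all? λ _ → _ ≟ _} _
cycDist-interior interior4 = toWitness {a? = all? λ _ → _ ≟ _} _

cycDist-interior-≤ᵇ : ∀ {i a b} → Interior i a b → ∀ j k →
  (toℕ i ≡ᵇ toℕ j) ∨ (cycDist a j ≤ᵇ k) ∨ (cycDist b j ≤ᵇ k) ≡ (cycDist i j ≤ᵇ suc k)
cycDist-interior-≤ᵇ {i} {a} {b} int j k rewrite cycDist-interior int j with toℕ i ≡ᵇ toℕ j
... | true  = refl
... | false = trans (sym (⊓-≤ᵇ (cycDist a j) (cycDist b j) k)) (sym (suc-≤ᵇ (cycDist a j ⊓ cycDist b j) k))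

hexVertexDist : Fin 6 → Fin 6 × Fin 6 → ℕ → Bool
hexVertexDist i (c , d) j = (cycDist i c ≤ᵇ j) ∨ (cycDist i d ≤ᵇ j)

hexEdgeDist : Fin 6 × Fin 6 → Fin 6 × Fin 6 → ℕ → Bool
hexEdgeDist (x , y) (c , d) zero    = sameE (toℕ x , toℕ y) (toℕ c , toℕ d)
hexEdgeDist (x , y) (c , d) (suc m) =
  sameE (toℕ x , toℕ y) (toℕ c , toℕ d)
  ∨ (cycDist x c ≤ᵇ m) ∨ (cycDist x d ≤ᵇ m) ∨ (cycDist y c ≤ᵇ m) ∨ (cycDist y d ≤ᵇ m)

hexPath-from-1 : distPoly (hexVertexDist i1) hexPath ≈ₚ cst (2 ∷ 1 ∷ 2 ∷ [])
hexPath-from-1 = ≈ₚ-by-evaluation 4 _ _ _ (λ _ → refl)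

hexPath-from-2 : distPoly (hexVertexDist i2) hexPath ≈ₚ cst (2 ∷ 2 ∷ 1 ∷ [])
hexPath-from-2 = ≈ₚ-by-evaluation 4 _ _ _ (λ _ → refl)

hexPath-from-3 : distPoly (hexVertexDist i3) hexPath ≈ₚ cst (2 ∷ 2 ∷ 1 ∷ [])
hexPath-from-3 = ≈ₚ-by-evaluation 4 _ _ _ (λ _ → refl)

hexPath-from-4 : distPoly (hexVertexDist i4) hexPath ≈ₚ cst (2 ∷ 1 ∷ 2 ∷ [])
hexPath-from-4 = ≈ₚ-by-evaluation 4 _ _ _ (λ _ → refl)

hexPath-from-12 : distPoly (hexEdgeDist (i1 , i2)) hexPath ≈ₚ cst (1 ∷ 2 ∷ 1 ∷ 1 ∷ [])
hexPath-from-12 = ≈ₚ-by-evaluation 5 _ _ _ (λ _ → refl)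

hexPath-from-23 : distPoly (hexEdgeDist (i2 , i3)) hexPath ≈ₚ cst (1 ∷ 2 ∷ 2 ∷ [])
hexPath-from-23 = ≈ₚ-by-evaluation 5 _ _ _ (λ _ → refl)

hexPath-from-34 : distPoly (hexEdgeDist (i3 , i4)) hexPath ≈ₚ cst (1 ∷ 2 ∷ 1 ∷ 1 ∷ [])
hexPath-from-34 = ≈ₚ-by-evaluation 5 _ _ _ (λ _ → refl)

hexPath-pairs : distPoly (λ p → hexEdgeDist (proj₁ p) (proj₂ p)) (upairs hexPath) ≈ₚ cst (5 ∷ 4 ∷ 4 ∷ 2 ∷ [])
hexPath-pairs = ≈ₚ-by-evaluation 5 _ _ _ (λ _ → refl)

-- Annelating a hexagon

-- G, all of whose vertices are below n, can take the hexagon u n (1+n) (2+n) (3+n) v over its edge uv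
record Annelable (G : Graph) (u v n : ℕ) : Set where
  field
    bounded : ∀ {e} → e ∈ G → proj₁ e < n × proj₂ e < n
    uv∈G    : (u , v) ∈ G
    u≢v     : u ≢ v
    uv-once : count (sameE (u , v)) G ≡ 1

module Annelation {G u v n} (A : Annelable G u v n) where
  open Annelable A

  hex : Fin 6 → ℕ
  hex i0 = u
  hex i1 = n
  hex i2 = 1 + n
  hex i3 = 2 + n
  hex i4 = 3 + n
  hex i5 = v

  hexEdge : Fin 6 × Fin 6 → Edge
  hexEdge (i , j) = hex i , hex j

  newEdges : Graph
  newEdges = map hexEdge hexPath

  G⁺ : Graph
  G⁺ = G ++ newEdges

  u<n : u < n
  u<n = proj₁ (bounded uv∈G)

  v<n : v < n
  v<n = proj₂ (bounded uv∈G)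

  G⊆G⁺ : ∀ {e} → e ∈ G → e ∈ G⁺
  G⊆G⁺ = ∈-++⁺ˡ

  hexPath⊆G⁺ : ∀ {ij} → ij ∈ hexPath → hexEdge ij ∈ G⁺
  hexPath⊆G⁺ m = ∈-++⁺ʳ G (∈-map⁺ hexEdge m)

  n≤new : ∀ {i} → New i → n ≤ hex i
  n≤new new1 = m≤n+m n 0
  n≤new new2 = m≤n+m n 1
  n≤new new3 = m≤n+m n 2
  n≤new new4 = m≤n+m n 3

  old≢new : ∀ {i x} → New i → x < n → x ≢ hex i
  old≢new i-new x<n refl = <⇒≱ x<n (n≤new i-new)

  private
    offset : ℕ → Fin 6
    offset 0 = i1
    offset 1 = i2
    offset 2 = i3
    offset _ = i4

    decode : ℕ → Fin 6
    decode x = if x <ᵇ n then (if x ≡ᵇ u then i0 else i5) else offset (x ∸ n)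

    new≮ᵇn : ∀ {i} → New i → (hex i <ᵇ n) ≡ false
    new≮ᵇn i-new = ¬T⇒≡false (λ h → old≢new i-new (<ᵇ⇒< _ n h) refl)

    decode-hex : ∀ i → decode (hex i) ≡ i
    decode-hex i0 rewrite T⇒≡true (<⇒<ᵇ u<n) | T⇒≡true (≡ᵇ-refl u) = refl
    decode-hex i5 rewrite T⇒≡true (<⇒<ᵇ v<n) | ¬T⇒≡false (λ h → u≢v (sym (≡ᵇ⇒≡ v u h))) = refl
    decode-hex i1 rewrite new≮ᵇn new1 | n∸n≡0 n = refl
    decode-hex i2 rewrite new≮ᵇn new2 | m+n∸n≡m 1 n = refl
    decode-hex i3 rewrite new≮ᵇn new3 | m+n∸n≡m 2 n = refl
    decode-hex i4 rewrite new≮ᵇn new4 | m+n∸n≡m 3 n = refl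

  hex-injective : ∀ {i j} → hex i ≡ hex j → i ≡ j
  hex-injective {i} {j} eq = trans (sym (decode-hex i)) (trans (cong decode eq) (decode-hex j))

  hex-≡ᵇ : ∀ i j → (hex i ≡ᵇ hex j) ≡ (toℕ i ≡ᵇ toℕ j)
  hex-≡ᵇ i j = T-ext (λ h → ≡⇒≡ᵇ (toℕ i) (toℕ j) (cong toℕ (hex-injective (≡ᵇ⇒≡ (hex i) (hex j) h))))
                     (λ h → ≡⇒≡ᵇ (hex i) (hex j) (cong hex (toℕ-injective (≡ᵇ⇒≡ (toℕ i) (toℕ j) h))))

  PathAdj⇒Adj⁺ : ∀ {i j} → PathAdj i j → Adj G⁺ (hex i) (hex j)
  PathAdj⇒Adj⁺ (inj₁ m) = inj₁ (hexPath⊆G⁺ m)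
  PathAdj⇒Adj⁺ (inj₂ m) = inj₂ (hexPath⊆G⁺ m)

  Adj-bounded : ∀ {x c} → Adj G x c → x < n × c < n
  Adj-bounded (inj₁ m) = bounded m
  Adj-bounded (inj₂ m) = let x<n , c<n = bounded m in c<n , x<n

  Adj⁺-cases : ∀ {x c} → Adj G⁺ x c → Adj G x c ⊎ ∃[ i ] ∃[ j ] PathAdj i j × x ≡ hex i × c ≡ hex j
  Adj⁺-cases (inj₁ m) with ∈-++⁻ G m
  ... | inj₁ m' = inj₁ (inj₁ m')
  ... | inj₂ m' with ∈-map⁻ hexEdge m'
  ... | (i , j) , ij∈ , refl = inj₂ (i , j , inj₁ ij∈ , refl , refl)
  Adj⁺-cases (inj₂ m) with ∈-++⁻ G m
  ... | inj₁ m' = inj₁ (inj₂ m')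
  ... | inj₂ m' with ∈-map⁻ hexEdge m'
  ... | (i , j) , ij∈ , refl = inj₂ (j , i , inj₂ ij∈ , refl , refl)

  withinV⁺-interior : ∀ {i a b} → Interior i a b → ∀ k y →
    withinV G⁺ (suc k) (hex i) y ≡ (hex i ≡ᵇ y) ∨ withinV G⁺ k (hex a) y ∨ withinV G⁺ k (hex b) y
  withinV⁺-interior {i} {a} {b} int k y = T-ext to from
    where
    to : T (withinV G⁺ (suc k) (hex i) y) → T ((hex i ≡ᵇ y) ∨ withinV G⁺ k (hex a) y ∨ withinV G⁺ k (hex b) y)
    to h with withinV-step⁻ G⁺ k (hex i) y h
    ... | inj₁ i≡y = T-∨⁺ˡ _ (≡⇒≡ᵇ (hex i) y i≡y)
    ... | inj₂ (c , ic , w) with Adj⁺-cases ic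
    ... | inj₁ icG = ⊥-elim (old≢new (Interior-new int) (proj₁ (Adj-bounded icG)) refl)
    ... | inj₂ (i' , j , ij , i≡i' , refl) with refl ← hex-injective {i} {i'} i≡i' | Interior-only int ij
    ... | inj₁ refl = T-∨⁺ʳ (hex i ≡ᵇ y) (T-∨⁺ˡ _ w)
    ... | inj₂ refl = T-∨⁺ʳ (hex i ≡ᵇ y) (T-∨⁺ʳ (withinV G⁺ k (hex a) y) w)
    from : T ((hex i ≡ᵇ y) ∨ withinV G⁺ k (hex a) y ∨ withinV G⁺ k (hex b) y) → T (withinV G⁺ (suc k) (hex i) y)
    from h with T-∨⁻ (hex i ≡ᵇ y) h
    ... | inj₁ p = withinV-step⁺ G⁺ k (hex i) y (inj₁ (≡ᵇ⇒≡ (hex i) y p))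
    ... | inj₂ h₂ with T-∨⁻ (withinV G⁺ k (hex a) y) h₂
    ... | inj₁ p = withinV-step⁺ G⁺ k (hex i) y (inj₂ (hex a , PathAdj⇒Adj⁺ (Interior-adjˡ int) , p))
    ... | inj₂ p = withinV-step⁺ G⁺ k (hex i) y (inj₂ (hex b , PathAdj⇒Adj⁺ (Interior-adjʳ int) , p))

  fromU fromV : ℕ → ℕ → Bool
  fromU b k = withinV G k u b
  fromV b k = withinV G k v b

  -- a walk from a new vertex to an old one leaves the hexagon through u or v, and since
  -- uv ∈ G the exit nearer along the path is never worse
  viaHex : Fin 6 → ℕ → ℕ → Bool
  viaHex i0 b = fromU b
  viaHex i1 b = shift (fromU b)
  viaHex i2 b = shift (shift (fromU b))
  viaHex i3 b = shift (shift (fromV b))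
  viaHex i4 b = shift (fromV b)
  viaHex i5 b = fromV b

  fromU-monotone : ∀ b → Monotone (fromU b)
  fromU-monotone b m = withinV-suc G m u b

  fromV-monotone : ∀ b → Monotone (fromV b)
  fromV-monotone b m = withinV-suc G m v b

  shift-fromV≤fromU : ∀ b k → T (shift (fromV b) k) → T (fromU b k)
  shift-fromV≤fromU b (suc k) h = withinV-step⁺ G k u b (inj₂ (v , inj₁ uv∈G , h))

  shift-fromU≤fromV : ∀ b k → T (shift (fromU b) k) → T (fromV b k)
  shift-fromU≤fromV b (suc k) h = withinV-step⁺ G k v b (inj₂ (u , inj₂ uv∈G , h))

  new≢ᵇold : ∀ {i} → New i → ∀ b → b < n → (hex i ≡ᵇ b) ≡ false
  new≢ᵇold i-new b b<n = ¬T⇒≡false (λ h → old≢new i-new b<n (sym (≡ᵇ⇒≡ _ b h)))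

  record Distances (k : ℕ) : Set where
    field
      old : ∀ x b → x < n → b < n → withinV G⁺ k x b ≡ withinV G k x b
      new : ∀ {i} → New i → ∀ b → b < n → withinV G⁺ k (hex i) b ≡ viaHex i b k

    hexToOld : ∀ i b → b < n → withinV G⁺ k (hex i) b ≡ viaHex i b k
    hexToOld i0 b b<n = old u b u<n b<n
    hexToOld i1 b b<n = new new1 b b<n
    hexToOld i2 b b<n = new new2 b b<n
    hexToOld i3 b b<n = new new3 b b<n
    hexToOld i4 b b<n = new new4 b b<n
    hexToOld i5 b b<n = old v b v<n b<n

  module _ {k} (D : Distances k) where
    open Distances D

    old-step : ∀ x b → x < n → b < n → withinV G⁺ (suc k) x b ≡ withinV G (suc k) x b
    old-step x b x<n b<n = T-ext to (withinV-⊆ G⊆G⁺ (suc k) x b)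
      where
      to : T (withinV G⁺ (suc k) x b) → T (withinV G (suc k) x b)
      to h with withinV-step⁻ G⁺ k x b h
      ... | inj₁ x≡b = withinV-step⁺ G k x b (inj₁ x≡b)
      ... | inj₂ (c , xc , w) with Adj⁺-cases xc
      ... | inj₁ xcG = withinV-step⁺ G k x b (inj₂ (c , xcG , subst T (old c b (proj₂ (Adj-bounded xcG)) b<n) w))
      ... | inj₂ (i0 , j , ij , refl , refl) with refl ← PathAdj-u ij =
        withinV-suc G k u b (shift-≤ (fromU-monotone b) k (subst T (new new1 b b<n) w))
      ... | inj₂ (i5 , j , ij , refl , refl) with refl ← PathAdj-v ij =
        withinV-suc G k v b (shift-≤ (fromV-monotone b) k (subst T (new new4 b b<n) w))
      ... | inj₂ (i1 , j , ij , refl , refl) = ⊥-elim (old≢new new1 x<n refl)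
      ... | inj₂ (i2 , j , ij , refl , refl) = ⊥-elim (old≢new new2 x<n refl)
      ... | inj₂ (i3 , j , ij , refl , refl) = ⊥-elim (old≢new new3 x<n refl)
      ... | inj₂ (i4 , j , ij , refl , refl) = ⊥-elim (old≢new new4 x<n refl)

    new-step : ∀ {i} → New i → ∀ b → b < n → withinV G⁺ (suc k) (hex i) b ≡ viaHex i b (suc k)
    new-step new1 b b<n
      rewrite withinV⁺-interior interior1 k b | new≢ᵇold new1 b b<n | hexToOld i0 b b<n | hexToOld i2 b b<n =
      ∨-absorbʳ (fromU b k) (shift-≤ (fromU-monotone b) k ∘ shift-≤ (shift-monotone (fromU-monotone b)) k)
    new-step new2 b b<n
      rewrite withinV⁺-interior interior2 k b | new≢ᵇold new2 b b<n | hexToOld i1 b b<n | hexToOld i3 b b<n =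
      ∨-absorbʳ (shift (fromU b) k) (shift-preserves-≤ (shift-fromV≤fromU b) k)
    new-step new3 b b<n
      rewrite withinV⁺-interior interior3 k b | new≢ᵇold new3 b b<n | hexToOld i2 b b<n | hexToOld i4 b b<n =
      ∨-absorbˡ (shift (fromV b) k) (shift-preserves-≤ (shift-fromU≤fromV b) k)
    new-step new4 b b<n
      rewrite withinV⁺-interior interior4 k b | new≢ᵇold new4 b b<n | hexToOld i3 b b<n | hexToOld i5 b b<n =
      ∨-absorbˡ (fromV b k) (shift-≤ (fromV-monotone b) k ∘ shift-≤ (shift-monotone (fromV-monotone b)) k)

  distances : ∀ k → Distances k
  distances zero = record { old = λ _ _ _ _ → refl ; new = new-at-0 }
    where
    new-at-0 : ∀ {i} → New i → ∀ b → b < n → withinV G⁺ 0 (hex i) b ≡ viaHex i b 0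
    new-at-0 new1 = new≢ᵇold new1
    new-at-0 new2 = new≢ᵇold new2
    new-at-0 new3 = new≢ᵇold new3
    new-at-0 new4 = new≢ᵇold new4
  distances (suc k) = record { old = old-step (distances k) ; new = new-step (distances k) }

  withinV⁺-old : ∀ k x b → x < n → b < n → withinV G⁺ k x b ≡ withinV G k x b
  withinV⁺-old k = Distances.old (distances k)

  withinV⁺-hexToOld : ∀ k i b → b < n → withinV G⁺ k (hex i) b ≡ viaHex i b k
  withinV⁺-hexToOld k = Distances.hexToOld (distances k)

  withinV⁺-hex : ∀ k i j → withinV G⁺ k (hex i) (hex j) ≡ (cycDist i j ≤ᵇ k)
  withinV⁺-hex zero i j = trans (hex-≡ᵇ i j) (cycDist-≤ᵇ0 i j)
  withinV⁺-hex (suc k) = go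
    where
    interior : ∀ {i a b} → Interior i a b → ∀ j → withinV G⁺ (suc k) (hex i) (hex j) ≡ (cycDist i j ≤ᵇ suc k)
    interior {i} {a} {b} int j
      rewrite withinV⁺-interior int k (hex j) | hex-≡ᵇ i j | withinV⁺-hex k a j | withinV⁺-hex k b j =
      cycDist-interior-≤ᵇ int j k
    interior⁻ : ∀ {i a b} → Interior i a b → ∀ j → withinV G⁺ (suc k) (hex j) (hex i) ≡ (cycDist j i ≤ᵇ suc k)
    interior⁻ {i} int j rewrite withinV-comm G⁺ (suc k) (hex j) (hex i) | cycDist-comm j i = interior int j
    u→v : T (withinV G⁺ (suc k) u v)
    u→v = withinV-step⁺ G⁺ k u v (inj₂ (v , inj₁ (G⊆G⁺ uv∈G) , withinV-refl G⁺ k v))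
    go : ∀ i j → withinV G⁺ (suc k) (hex i) (hex j) ≡ (cycDist i j ≤ᵇ suc k)
    go i1 j  = interior interior1 j
    go i2 j  = interior interior2 j
    go i3 j  = interior interior3 j
    go i4 j  = interior interior4 j
    go i0 i1 = interior⁻ interior1 i0
    go i0 i2 = interior⁻ interior2 i0
    go i0 i3 = interior⁻ interior3 i0
    go i0 i4 = interior⁻ interior4 i0
    go i5 i1 = interior⁻ interior1 i5
    go i5 i2 = interior⁻ interior2 i5
    go i5 i3 = interior⁻ interior3 i5
    go i5 i4 = interior⁻ interior4 i5
    go i0 i0 = T⇒≡true (withinV-refl G⁺ (suc k) u)
    go i5 i5 = T⇒≡true (withinV-refl G⁺ (suc k) v)
    go i0 i5 = T⇒≡true u→v
    go i5 i0 = T⇒≡true (withinV-sym G⁺ (suc k) u v u→v)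

  α₀ β₀ γ₀ δ₀ : Poly
  α₀ = HeG G
  β₀ = HeV G u
  γ₀ = HeV G v
  δ₀ = HeE G (u , v)

  nearU nearV : Edge → ℕ → Bool
  nearU f m = fromU (proj₁ f) m ∨ fromU (proj₂ f) m
  nearV f m = fromV (proj₁ f) m ∨ fromV (proj₂ f) m

  newEdge≢old : ∀ {x y} → New x ⊎ New y → ∀ {f} → f ∈ G → sameE (hex x , hex y) f ≡ false
  newEdge≢old {x} {y} new {a , b} f∈G = ¬T⇒≡false (λ h → absurd new (sameE⁻ (hex x) (hex y) a b h))
    where
    a<n = proj₁ (bounded f∈G)
    b<n = proj₂ (bounded f∈G)
    absurd : New x ⊎ New y → (hex x ≡ a × hex y ≡ b) ⊎ (hex x ≡ b × hex y ≡ a) → ⊥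
    absurd (inj₁ x-new) (inj₁ (e , _)) = old≢new x-new a<n (sym e)
    absurd (inj₁ x-new) (inj₂ (e , _)) = old≢new x-new b<n (sym e)
    absurd (inj₂ y-new) (inj₁ (_ , e)) = old≢new y-new b<n (sym e)
    absurd (inj₂ y-new) (inj₂ (_ , e)) = old≢new y-new a<n (sym e)

  withinE⁺-newToOld : ∀ {x y} → New x ⊎ New y → ∀ m a b → (a , b) ∈ G →
    withinE G⁺ (suc m) (hex x , hex y) (a , b) ≡ viaHex x a m ∨ viaHex x b m ∨ viaHex y a m ∨ viaHex y b m
  withinE⁺-newToOld {x} {y} new m a b ab∈G
    rewrite withinE-unfold G⁺ m (hex x , hex y) (a , b) (G⊆G⁺ ab∈G) | newEdge≢old new ab∈G
          | withinV⁺-hexToOld m x a (proj₁ (bounded ab∈G)) | withinV⁺-hexToOld m x b (proj₂ (bounded ab∈G))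
          | withinV⁺-hexToOld m y a (proj₁ (bounded ab∈G)) | withinV⁺-hexToOld m y b (proj₂ (bounded ab∈G)) = refl

  module _ {a b} (ab∈G : (a , b) ∈ G) where

    withinE⁺-01 : ∀ j → withinE G⁺ j (hexEdge (i0 , i1)) (a , b) ≡ shift (nearU (a , b)) j
    withinE⁺-01 zero    = newEdge≢old {i0} {i1} (inj₂ new1) ab∈G
    withinE⁺-01 (suc m) = trans (withinE⁺-newToOld {i0} {i1} (inj₂ new1) m a b ab∈G)
      (∨-absorb₂ʳ (fromU a m) _ (shift-≤ (fromU-monotone _) m) (shift-≤ (fromU-monotone _) m))

    withinE⁺-12 : ∀ j → withinE G⁺ j (hexEdge (i1 , i2)) (a , b) ≡ shift (shift (nearU (a , b))) j
    withinE⁺-12 zero    = newEdge≢old {i1} {i2} (inj₁ new1) ab∈G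
    withinE⁺-12 (suc m) = trans (withinE⁺-newToOld {i1} {i2} (inj₁ new1) m a b ab∈G)
      (trans (∨-absorb₂ʳ (shift (fromU a) m) _ (shift-≤ (shift-monotone (fromU-monotone _)) m)
                                                  (shift-≤ (shift-monotone (fromU-monotone _)) m))
             (shift-∨ (fromU a) (fromU b) m))

    withinE⁺-23 : ∀ j → withinE G⁺ j (hexEdge (i2 , i3)) (a , b)
                        ≡ shift (shift (shift (λ m → endsWithin G m (u , v) (a , b)))) j
    withinE⁺-23 zero    = newEdge≢old {i2} {i3} (inj₁ new2) ab∈G
    withinE⁺-23 (suc m) = trans (withinE⁺-newToOld {i2} {i3} (inj₁ new2) m a b ab∈G) (shift²-∨₄ m)
      where
      shift²-∨₄ : ∀ m → viaHex i2 a m ∨ viaHex i2 b m ∨ viaHex i3 a m ∨ viaHex i3 b m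
                        ≡ shift (shift (λ m → endsWithin G m (u , v) (a , b))) m
      shift²-∨₄ zero          = refl
      shift²-∨₄ (suc zero)    = refl
      shift²-∨₄ (suc (suc m)) = refl

    withinE⁺-34 : ∀ j → withinE G⁺ j (hexEdge (i3 , i4)) (a , b) ≡ shift (shift (nearV (a , b))) j
    withinE⁺-34 zero    = newEdge≢old {i3} {i4} (inj₁ new3) ab∈G
    withinE⁺-34 (suc m) = trans (withinE⁺-newToOld {i3} {i4} (inj₁ new3) m a b ab∈G)
      (trans (∨-absorb₂ˡ (shift (fromV a) m) _ (shift-≤ (shift-monotone (fromV-monotone _)) m)
                                                  (shift-≤ (shift-monotone (fromV-monotone _)) m))
             (shift-∨ (fromV a) (fromV b) m))

    withinE⁺-45 : ∀ j → withinE G⁺ j (hexEdge (i4 , i5)) (a , b) ≡ shift (nearV (a , b)) j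
    withinE⁺-45 zero    = newEdge≢old {i4} {i5} (inj₁ new4) ab∈G
    withinE⁺-45 (suc m) = trans (withinE⁺-newToOld {i4} {i5} (inj₁ new4) m a b ab∈G)
      (∨-absorb₂ˡ (fromV a m) _ (shift-≤ (fromV-monotone _) m) (shift-≤ (fromV-monotone _) m))

  toOld toNew : Edge → Poly
  toOld e = distPoly (λ f j → withinE G⁺ j e f) G
  toNew e = distPoly (λ f j → withinE G⁺ j e f) newEdges

  HeE⁺-split : ∀ e → HeE G⁺ e ≈ₚ toOld e ⊕ toNew e
  HeE⁺-split e k = count-++ _ G newEdges

  toOld-01 : toOld (hexEdge (i0 , i1)) ≈ₚ X* β₀
  toOld-01 = ≈ₚ-trans (distPoly-cong G (λ { (a , b) ab∈G → withinE⁺-01 ab∈G })) (distPoly-shift nearU G)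

  toOld-12 : toOld (hexEdge (i1 , i2)) ≈ₚ X* (X* β₀)
  toOld-12 = ≈ₚ-trans (distPoly-cong G (λ { (a , b) ab∈G → withinE⁺-12 ab∈G }))
                      (≈ₚ-trans (distPoly-shift (λ f → shift (nearU f)) G) (X*-cong (distPoly-shift nearU G)))

  toOld-34 : toOld (hexEdge (i3 , i4)) ≈ₚ X* (X* γ₀)
  toOld-34 = ≈ₚ-trans (distPoly-cong G (λ { (a , b) ab∈G → withinE⁺-34 ab∈G }))
                      (≈ₚ-trans (distPoly-shift (λ f → shift (nearV f)) G) (X*-cong (distPoly-shift nearV G)))

  toOld-45 : toOld (hexEdge (i4 , i5)) ≈ₚ X* γ₀
  toOld-45 = ≈ₚ-trans (distPoly-cong G (λ { (a , b) ab∈G → withinE⁺-45 ab∈G })) (distPoly-shift nearV G)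

  -- the new edge (1+n)(2+n) is at distance 2 + d(uv, f) from every old edge f except uv itself, at distance 3
  toOld-23 : toOld (hexEdge (i2 , i3)) ⊕ cst (0 ∷ 0 ∷ 1 ∷ []) ≈ₚ X* (X* δ₀) ⊕ cst (0 ∷ 0 ∷ 0 ∷ 1 ∷ [])
  toOld-23 k = begin
    toOld (hexEdge (i2 , i3)) k + cst (0 ∷ 0 ∷ 1 ∷ []) k
      ≡⟨ cong (toOld (hexEdge (i2 , i3)) k +_) (sym (exactly-shift²-always k)) ⟩
    toOld (hexEdge (i2 , i3)) k + 𝟙 (exactly (shift (shift always)) k)
      ≡⟨ count-except-one _ _ (sameE (u , v)) _ _ G uv-once off-uv at-uv ⟩
    distPoly around-uv G k + 𝟙 (exactly (shift (shift (shift always))) k)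
      ≡⟨ cong₂ _+_ (≈ₚ-trans (distPoly-shift _ G) (X*-cong (distPoly-shift _ G)) k) (exactly-shift³-always k) ⟩
    X* (X* δ₀) k + cst (0 ∷ 0 ∷ 0 ∷ 1 ∷ []) k ∎
    where
    open ≡-Reasoning
    from₂₃ around-uv : Edge → ℕ → Bool
    from₂₃ f j = withinE G⁺ j (hexEdge (i2 , i3)) f
    around-uv f = shift (shift (λ j → withinE G j (u , v) f))
    off-uv : ∀ f → f ∈ G → sameE (u , v) f ≡ false → exactly (from₂₃ f) k ≡ exactly (around-uv f) k
    off-uv (a , b) ab∈G uv≢f = exactly-cong (λ j → trans (withinE⁺-23 ab∈G j)
      (shift-cong (shift-cong (withinE-distinct G ab∈G uv≢f)) j)) k
    at-uv : ∀ f → f ∈ G → sameE (u , v) f ≡ true →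
            exactly (from₂₃ f) k ≡ exactly (shift (shift (shift always))) k
            × exactly (around-uv f) k ≡ exactly (shift (shift always)) k
    at-uv (a , b) ab∈G uv≡f =
      exactly-cong (λ j → trans (withinE⁺-23 ab∈G j) (shift-cong (shift-cong (shift-cong ends)) j)) k ,
      exactly-cong (shift-cong (shift-cong (λ m → T⇒≡true (withinE-same G m _ _ (≡true⇒T uv≡f))))) k
      where
      ends : ∀ m → endsWithin G m (u , v) (a , b) ≡ true
      ends m with sameE⁻ u v a b (≡true⇒T uv≡f)
      ... | inj₁ (u≡a , _) = T⇒≡true (endsWithin⁺ G m u v a b u u (inj₁ refl) (inj₁ u≡a) (withinV-refl G m u))
      ... | inj₂ (u≡b , _) = T⇒≡true (endsWithin⁺ G m u v a b u u (inj₁ refl) (inj₂ u≡b) (withinV-refl G m u))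

  fromHex : Fin 6 → Edge → ℕ → Bool
  fromHex i f j = withinV G⁺ j (hex i) (proj₁ f) ∨ withinV G⁺ j (hex i) (proj₂ f)

  HeV⁺-split : ∀ i → HeV G⁺ (hex i) ≈ₚ distPoly (fromHex i) G ⊕ distPoly (fromHex i) newEdges
  HeV⁺-split i k = count-++ _ G newEdges

  fromHex-new : ∀ i → distPoly (fromHex i) newEdges ≈ₚ distPoly (hexVertexDist i) hexPath
  fromHex-new i k = trans (count-map (λ f → exactly (fromHex i f) k) hexEdge hexPath)
    (distPoly-cong hexPath (λ { (c , d) _ j → cong₂ _∨_ (withinV⁺-hex j i c) (withinV⁺-hex j i d) }) k)

  fromHex-old : ∀ i → distPoly (fromHex i) G ≈ₚ distPoly (λ f j → viaHex i (proj₁ f) j ∨ viaHex i (proj₂ f) j) G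
  fromHex-old i = distPoly-cong G (λ { (a , b) ab∈G j →
    cong₂ _∨_ (withinV⁺-hexToOld j i a (proj₁ (bounded ab∈G))) (withinV⁺-hexToOld j i b (proj₂ (bounded ab∈G))) })

  HeV⁺-1 : HeV G⁺ (hex i1) ≈ₚ X* β₀ ⊕ cst (2 ∷ 1 ∷ 2 ∷ [])
  HeV⁺-1 = ≈ₚ-trans (HeV⁺-split i1) (⊕-cong
    (≈ₚ-trans (fromHex-old i1) (≈ₚ-trans (distPoly-cong G (λ f _ → shift-∨ _ _)) (distPoly-shift nearU G)))
    (≈ₚ-trans (fromHex-new i1) hexPath-from-1))

  HeV⁺-2 : HeV G⁺ (hex i2) ≈ₚ X* (X* β₀) ⊕ cst (2 ∷ 2 ∷ 1 ∷ [])
  HeV⁺-2 = ≈ₚ-trans (HeV⁺-split i2) (⊕-cong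
    (≈ₚ-trans (fromHex-old i2) (≈ₚ-trans (distPoly-cong G (λ f _ → shift²-∨ _ _))
      (≈ₚ-trans (distPoly-shift (λ f → shift (nearU f)) G) (X*-cong (distPoly-shift nearU G)))))
    (≈ₚ-trans (fromHex-new i2) hexPath-from-2))

  HeV⁺-3 : HeV G⁺ (hex i3) ≈ₚ X* (X* γ₀) ⊕ cst (2 ∷ 2 ∷ 1 ∷ [])
  HeV⁺-3 = ≈ₚ-trans (HeV⁺-split i3) (⊕-cong
    (≈ₚ-trans (fromHex-old i3) (≈ₚ-trans (distPoly-cong G (λ f _ → shift²-∨ _ _))
      (≈ₚ-trans (distPoly-shift (λ f → shift (nearV f)) G) (X*-cong (distPoly-shift nearV G)))))
    (≈ₚ-trans (fromHex-new i3) hexPath-from-3))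

  HeV⁺-4 : HeV G⁺ (hex i4) ≈ₚ X* γ₀ ⊕ cst (2 ∷ 1 ∷ 2 ∷ [])
  HeV⁺-4 = ≈ₚ-trans (HeV⁺-split i4) (⊕-cong
    (≈ₚ-trans (fromHex-old i4) (≈ₚ-trans (distPoly-cong G (λ f _ → shift-∨ _ _)) (distPoly-shift nearV G)))
    (≈ₚ-trans (fromHex-new i4) hexPath-from-4))

  sameE-hex : ∀ x y c d → sameE (hex x , hex y) (hex c , hex d) ≡ sameE (toℕ x , toℕ y) (toℕ c , toℕ d)
  sameE-hex x y c d rewrite hex-≡ᵇ x c | hex-≡ᵇ y d | hex-≡ᵇ x d | hex-≡ᵇ y c = refl

  withinE⁺-hex : ∀ e e' → e' ∈ hexPath → ∀ j → withinE G⁺ j (hexEdge e) (hexEdge e') ≡ hexEdgeDist e e' j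
  withinE⁺-hex (x , y) (c , d) _ zero = sameE-hex x y c d
  withinE⁺-hex (x , y) (c , d) e'∈ (suc m)
    rewrite withinE-unfold G⁺ m (hex x , hex y) (hex c , hex d) (hexPath⊆G⁺ e'∈) | sameE-hex x y c d
          | withinV⁺-hex m x c | withinV⁺-hex m x d | withinV⁺-hex m y c | withinV⁺-hex m y d = refl

  toNew-hex : ∀ e → toNew (hexEdge e) ≈ₚ distPoly (hexEdgeDist e) hexPath
  toNew-hex e k = trans (count-map (λ f → exactly (λ j → withinE G⁺ j (hexEdge e) f) k) hexEdge hexPath)
                        (distPoly-cong hexPath (λ e' e'∈ → withinE⁺-hex e e' e'∈) k)

  HeE⁺-12 : HeE G⁺ (hexEdge (i1 , i2)) ≈ₚ X* (X* β₀) ⊕ cst (1 ∷ 2 ∷ 1 ∷ 1 ∷ [])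
  HeE⁺-12 = ≈ₚ-trans (HeE⁺-split _) (⊕-cong toOld-12 (≈ₚ-trans (toNew-hex _) hexPath-from-12))

  HeE⁺-34 : HeE G⁺ (hexEdge (i3 , i4)) ≈ₚ X* (X* γ₀) ⊕ cst (1 ∷ 2 ∷ 1 ∷ 1 ∷ [])
  HeE⁺-34 = ≈ₚ-trans (HeE⁺-split _) (⊕-cong toOld-34 (≈ₚ-trans (toNew-hex _) hexPath-from-34))

  HeE⁺-23 : HeE G⁺ (hexEdge (i2 , i3)) ≈ₚ X* (X* δ₀) ⊕ cst (1 ∷ 2 ∷ 1 ∷ 1 ∷ [])
  HeE⁺-23 = ≈ₚ-trans (HeE⁺-split _)
    (⊕-exchange {q = toNew (hexEdge (i2 , i3))} {q' = cst (1 ∷ 2 ∷ 1 ∷ 1 ∷ [])} toOld-23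
      (≈ₚ-trans (⊕-cong (≈ₚ-trans (toNew-hex _) hexPath-from-23) (λ _ → refl))
                (≈ₚ-by-evaluation 5 (cst (1 ∷ 2 ∷ 2 ∷ []) ⊕ cst (0 ∷ 0 ∷ 0 ∷ 1 ∷ []))
                                    (cst (1 ∷ 2 ∷ 1 ∷ 1 ∷ []) ⊕ cst (0 ∷ 0 ∷ 1 ∷ [])) _ (λ _ → refl))))

  withinE⁺-old : ∀ {f g} → f ∈ G → g ∈ G → ∀ j → withinE G⁺ j f g ≡ withinE G j f g
  withinE⁺-old f∈G g∈G zero = refl
  withinE⁺-old {a , b} {c , d} f∈G g∈G (suc m)
    rewrite withinE-unfold G⁺ m (a , b) (c , d) (G⊆G⁺ g∈G) | withinE-unfold G m (a , b) (c , d) g∈G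
          | withinV⁺-old m a c (proj₁ (bounded f∈G)) (proj₁ (bounded g∈G))
          | withinV⁺-old m a d (proj₁ (bounded f∈G)) (proj₂ (bounded g∈G))
          | withinV⁺-old m b c (proj₂ (bounded f∈G)) (proj₁ (bounded g∈G))
          | withinV⁺-old m b d (proj₂ (bounded f∈G)) (proj₂ (bounded g∈G)) = refl

  pairDist⁺ : Edge × Edge → ℕ → Bool
  pairDist⁺ (e , f) j = withinE G⁺ j e f

  HeG⁺-split : ∀ k → HeG G⁺ k ≡ distPoly pairDist⁺ (upairs G) k
                                 + sum (map (λ f → count (λ e → exactly (pairDist⁺ (f , e)) k) newEdges) G)
                                 + distPoly pairDist⁺ (upairs newEdges) k
  HeG⁺-split k = count-upairs-++ (λ ef → exactly (pairDist⁺ ef) k) G newEdges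

  oldPairs : distPoly pairDist⁺ (upairs G) ≈ₚ α₀
  oldPairs = distPoly-cong (upairs G) (λ { (f , g) fg∈ → let f∈G , g∈G = upairs-∈ G fg∈ in withinE⁺-old f∈G g∈G })

  newPairs : distPoly pairDist⁺ (upairs newEdges) ≈ₚ cst (5 ∷ 4 ∷ 4 ∷ 2 ∷ [])
  newPairs k rewrite upairs-map hexEdge hexPath =
    trans (count-map (λ ef → exactly (pairDist⁺ ef) k) _ (upairs hexPath))
          (trans (distPoly-cong (upairs hexPath)
                   (λ { (e , e') ee'∈ → withinE⁺-hex e e' (proj₂ (upairs-∈ hexPath ee'∈)) }) k)
                 (hexPath-pairs k))

  crossPairs : ∀ k → sum (map (λ f → count (λ e → exactly (pairDist⁺ (f , e)) k) newEdges) G)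
                     ≡ sum (map (λ e → toOld e k) newEdges)
  crossPairs k = trans (sum-count-swap (λ f e → exactly (pairDist⁺ (f , e)) k) G newEdges)
                       (cong sum (map-cong-local (All.tabulate λ {e} e∈ → count-cong _ _ G (λ f f∈G →
                          exactly-cong (withinE-comm G⁺ f e (G⊆G⁺ f∈G) (∈-++⁺ʳ G e∈)) k))))

  HeG⁺ : HeG G⁺ ≈ₚ αStep α₀ β₀ γ₀ δ₀
  HeG⁺ = ≈ₚ-trans collect
           (≈ₚ-trans (⊕-cong {p = α₀ ⊕ S} (λ _ → refl) correct) (λ k → sym (+-assoc (α₀ k + S k) _ _)))
    where
    S : Poly
    S = X* (β₀ ⊕ γ₀) ⊕ X* (X* (β₀ ⊕ γ₀))
    e₂₃ = hexEdge (i2 , i3)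
    S-split : ∀ k → S k ≡ X* β₀ k + X* γ₀ k + (X* (X* β₀) k + X* (X* γ₀) k)
    S-split k = cong₂ _+_ (X*-⊕ β₀ γ₀ k) (trans (X*-cong (X*-⊕ β₀ γ₀) k) (X*-⊕ (X* β₀) (X* γ₀) k))
    collect : HeG G⁺ ≈ₚ (α₀ ⊕ S) ⊕ (toOld e₂₃ ⊕ cst (5 ∷ 4 ∷ 4 ∷ 2 ∷ []))
    collect k = begin
      HeG G⁺ k
        ≡⟨ HeG⁺-split k ⟩
      _ ≡⟨ cong₂ _+_ (cong₂ _+_ (oldPairs k) (crossPairs k)) (newPairs k) ⟩
      α₀ k + (toOld (hexEdge (i0 , i1)) k + (toOld (hexEdge (i1 , i2)) k + (toOld e₂₃ k
           + (toOld (hexEdge (i3 , i4)) k + (toOld (hexEdge (i4 , i5)) k + 0))))) + cst (5 ∷ 4 ∷ 4 ∷ 2 ∷ []) k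
        ≡⟨ cong (λ x → α₀ k + x + cst (5 ∷ 4 ∷ 4 ∷ 2 ∷ []) k) (cong₂ _+_ (toOld-01 k) (cong₂ _+_ (toOld-12 k)
             (cong (toOld e₂₃ k +_) (cong₂ _+_ (toOld-34 k) (cong (_+ 0) (toOld-45 k)))))) ⟩
      α₀ k + (X* β₀ k + (X* (X* β₀) k + (toOld e₂₃ k + (X* (X* γ₀) k + (X* γ₀ k + 0))))) + cst (5 ∷ 4 ∷ 4 ∷ 2 ∷ []) k
        ≡⟨ regroup (α₀ k) (X* β₀ k) (X* (X* β₀) k) (toOld e₂₃ k) (X* (X* γ₀) k) (X* γ₀ k) _ ⟩
      α₀ k + (X* β₀ k + X* γ₀ k + (X* (X* β₀) k + X* (X* γ₀) k)) + (toOld e₂₃ k + cst (5 ∷ 4 ∷ 4 ∷ 2 ∷ []) k)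
        ≡⟨ cong (λ x → α₀ k + x + (toOld e₂₃ k + cst (5 ∷ 4 ∷ 4 ∷ 2 ∷ []) k)) (sym (S-split k)) ⟩
      α₀ k + S k + (toOld e₂₃ k + cst (5 ∷ 4 ∷ 4 ∷ 2 ∷ []) k) ∎
      where
      open ≡-Reasoning
      regroup : ∀ a b₁ b₂ t c₂ c₁ r →
                a + (b₁ + (b₂ + (t + (c₂ + (c₁ + 0))))) + r ≡ a + (b₁ + c₁ + (b₂ + c₂)) + (t + r)
      regroup = solve-∀
    correct : toOld e₂₃ ⊕ cst (5 ∷ 4 ∷ 4 ∷ 2 ∷ []) ≈ₚ X* (X* δ₀) ⊕ cst (5 ∷ 4 ∷ 3 ∷ 3 ∷ [])
    correct = ⊕-exchange {q = cst (5 ∷ 4 ∷ 4 ∷ 2 ∷ [])} {q' = cst (5 ∷ 4 ∷ 3 ∷ 3 ∷ [])} toOld-23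
      (≈ₚ-by-evaluation 5 (cst (5 ∷ 4 ∷ 4 ∷ 2 ∷ []) ⊕ cst (0 ∷ 0 ∷ 0 ∷ 1 ∷ []))
                          (cst (5 ∷ 4 ∷ 3 ∷ 3 ∷ []) ⊕ cst (0 ∷ 0 ∷ 1 ∷ [])) _ (λ _ → refl))

  hex<4+n : ∀ i → hex i < 4 + n
  hex<4+n i0 = <-≤-trans u<n (m≤n+m n 4)
  hex<4+n i1 = m<n+m n {4} z<s
  hex<4+n i2 = s<s (m<n+m n {3} z<s)
  hex<4+n i3 = s<s (s<s (m<n+m n {2} z<s))
  hex<4+n i4 = s<s (s<s (s<s (m<n+m n {1} z<s)))
  hex<4+n i5 = <-≤-trans v<n (m≤n+m n 4)

  annelate-again : ∀ {a b} → (a , b) ∈ hexPath → Annelable G⁺ (hex a) (hex b) (4 + n)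
  annelate-again {a} {b} ab∈ = record
    { bounded = bounded⁺
    ; uv∈G    = hexPath⊆G⁺ ab∈
    ; u≢v     = λ eq → <⇒≢ (n<1+n (toℕ a)) (trans (cong toℕ (hex-injective {a} {b} eq)) (hexPath-step ab∈))
    ; uv-once = trans (count-++ _ G newEdges)
                      (cong₂ _+_ (count-false _ G (λ f f∈G → newEdge≢old (hexPath-new ab∈) f∈G))
                                 (trans (count-map (sameE (hex a , hex b)) hexEdge hexPath)
                                        (trans (count-cong _ _ hexPath (λ { (c , d) _ → sameE-hex a b c d }))
                                               (hexPath-once ab∈))))
    }
    where
    bounded⁺ : ∀ {e} → e ∈ G⁺ → proj₁ e < 4 + n × proj₂ e < 4 + n
    bounded⁺ e∈ with ∈-++⁻ G e∈
    ... | inj₁ e∈G = let x<n , y<n = bounded e∈G in <-≤-trans x<n (m≤n+m n 4) , <-≤-trans y<n (m≤n+m n 4)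
    ... | inj₂ e∈new with ∈-map⁻ hexEdge {xs = hexPath} e∈new
    ... | (i , j) , _ , refl = hex<4+n i , hex<4+n j

-- Benzenoid chains

fresh-suc : ∀ h → 4 + (2 + 4 * h) ≡ 2 + 4 * suc h
fresh-suc h = cong (2 +_) (sym (*-suc 4 h))

B-annelable : ∀ cs h → Annelable (graph (B cs h)) (u (B cs h)) (v (B cs h)) (2 + 4 * h)
B-annelable cs zero = record
  { bounded = λ { (here refl) → z<s , s<s z<s } ; uv∈G = here refl ; u≢v = λ () ; uv-once = refl }
B-annelable cs (suc h) with cs (suc h) | Annelation.annelate-again (B-annelable cs h)
... | case1 | again = subst (Annelable _ _ _) (fresh-suc h) (again (there (here refl)))
... | case2 | again = subst (Annelable _ _ _) (fresh-suc h) (again (there (there (here refl))))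
... | case3 | again = subst (Annelable _ _ _) (fresh-suc h) (again (there (there (there (here refl)))))

α-B : ∀ cs h → α cs h ≈ₚ HeG (graph (B cs h))
α-B cs zero    = ≈ₚ-by-evaluation 4 _ _ _ (λ _ → refl)
α-B cs (suc h) _ = refl

β-B : ∀ cs h → β cs h ≈ₚ HeV (graph (B cs h)) (u (B cs h))
β-B cs zero    = ≈ₚ-by-evaluation 4 _ _ _ (λ _ → refl)
β-B cs (suc h) _ = refl

γ-B : ∀ cs h → γ cs h ≈ₚ HeV (graph (B cs h)) (v (B cs h))
γ-B cs zero    = ≈ₚ-by-evaluation 4 _ _ _ (λ _ → refl)
γ-B cs (suc h) _ = refl

δ-B : ∀ cs h → δ cs h ≈ₚ HeE (graph (B cs h)) (u (B cs h) , v (B cs h))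
δ-B cs zero    = ≈ₚ-by-evaluation 4 _ _ _ (λ _ → refl)
δ-B cs (suc h) _ = refl

module _ (cs : ℕ → Case) (h : ℕ) where
  open Annelation (B-annelable cs h)

  α-recurrence : α cs (suc h) ≈ₚ αStep (α cs h) (β cs h) (γ cs h) (δ cs h)
  α-recurrence = ≈ₚ-trans HeG⁺
    (αStep-cong (≈ₚ-sym (α-B cs h)) (≈ₚ-sym (β-B cs h)) (≈ₚ-sym (γ-B cs h)) (≈ₚ-sym (δ-B cs h)))

  recurrences-case1 : cs (suc h) ≡ case1 →
    (β cs (suc h) ≈ₚ X* (β cs h) ⊕ cst (2 ∷ 1 ∷ 2 ∷ []))
    × (γ cs (suc h) ≈ₚ X* (X* (β cs h)) ⊕ cst (2 ∷ 2 ∷ 1 ∷ []))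
    × (δ cs (suc h) ≈ₚ X* (X* (β cs h)) ⊕ cst (1 ∷ 2 ∷ 1 ∷ 1 ∷ []))
  recurrences-case1 e with cs (suc h) | e
  ... | case1 | refl =
    ≈ₚ-trans HeV⁺-1 (⊕-cong (X*-cong (≈ₚ-sym (β-B cs h))) (λ _ → refl)) ,
    ≈ₚ-trans HeV⁺-2 (⊕-cong (X*-cong (X*-cong (≈ₚ-sym (β-B cs h)))) (λ _ → refl)) ,
    ≈ₚ-trans HeE⁺-12 (⊕-cong (X*-cong (X*-cong (≈ₚ-sym (β-B cs h)))) (λ _ → refl))

  recurrences-case2 : cs (suc h) ≡ case2 →
    (β cs (suc h) ≈ₚ X* (X* (β cs h)) ⊕ cst (2 ∷ 2 ∷ 1 ∷ []))
    × (γ cs (suc h) ≈ₚ X* (X* (γ cs h)) ⊕ cst (2 ∷ 2 ∷ 1 ∷ []))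
    × (δ cs (suc h) ≈ₚ X* (X* (δ cs h)) ⊕ cst (1 ∷ 2 ∷ 1 ∷ 1 ∷ []))
  recurrences-case2 e with cs (suc h) | e
  ... | case2 | refl =
    ≈ₚ-trans HeV⁺-2 (⊕-cong (X*-cong (X*-cong (≈ₚ-sym (β-B cs h)))) (λ _ → refl)) ,
    ≈ₚ-trans HeV⁺-3 (⊕-cong (X*-cong (X*-cong (≈ₚ-sym (γ-B cs h)))) (λ _ → refl)) ,
    ≈ₚ-trans HeE⁺-23 (⊕-cong (X*-cong (X*-cong (≈ₚ-sym (δ-B cs h)))) (λ _ → refl))

  recurrences-case3 : cs (suc h) ≡ case3 →
    (β cs (suc h) ≈ₚ X* (X* (γ cs h)) ⊕ cst (2 ∷ 2 ∷ 1 ∷ []))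
    × (γ cs (suc h) ≈ₚ X* (γ cs h) ⊕ cst (2 ∷ 1 ∷ 2 ∷ []))
    × (δ cs (suc h) ≈ₚ X* (X* (γ cs h)) ⊕ cst (1 ∷ 2 ∷ 1 ∷ 1 ∷ []))
  recurrences-case3 e with cs (suc h) | e
  ... | case3 | refl =
    ≈ₚ-trans HeV⁺-3 (⊕-cong (X*-cong (X*-cong (≈ₚ-sym (γ-B cs h)))) (λ _ → refl)) ,
    ≈ₚ-trans HeV⁺-4 (⊕-cong (X*-cong (≈ₚ-sym (γ-B cs h))) (λ _ → refl)) ,
    ≈ₚ-trans HeE⁺-34 (⊕-cong (X*-cong (X*-cong (≈ₚ-sym (γ-B cs h)))) (λ _ → refl))

theorem4p1 : (cs : ℕ → Case) (h : ℕ) → 1 ≤ h →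
  (α cs h ≈ₚ α cs (h ∸ 1) ⊕ (X* (β cs (h ∸ 1) ⊕ γ cs (h ∸ 1)) ⊕ X* (X* (β cs (h ∸ 1) ⊕ γ cs (h ∸ 1))))
             ⊕ X* (X* (δ cs (h ∸ 1))) ⊕ cst (5 ∷ 4 ∷ 3 ∷ 3 ∷ []))
  × (cs h ≡ case1 →
      (β cs h ≈ₚ X* (β cs (h ∸ 1)) ⊕ cst (2 ∷ 1 ∷ 2 ∷ []))
      × (γ cs h ≈ₚ X* (X* (β cs (h ∸ 1))) ⊕ cst (2 ∷ 2 ∷ 1 ∷ []))
      × (δ cs h ≈ₚ X* (X* (β cs (h ∸ 1))) ⊕ cst (1 ∷ 2 ∷ 1 ∷ 1 ∷ [])))
  × (cs h ≡ case2 →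
      (β cs h ≈ₚ X* (X* (β cs (h ∸ 1))) ⊕ cst (2 ∷ 2 ∷ 1 ∷ []))
      × (γ cs h ≈ₚ X* (X* (γ cs (h ∸ 1))) ⊕ cst (2 ∷ 2 ∷ 1 ∷ []))
      × (δ cs h ≈ₚ X* (X* (δ cs (h ∸ 1))) ⊕ cst (1 ∷ 2 ∷ 1 ∷ 1 ∷ [])))
  × (cs h ≡ case3 →
      (β cs h ≈ₚ X* (X* (γ cs (h ∸ 1))) ⊕ cst (2 ∷ 2 ∷ 1 ∷ []))
      × (γ cs h ≈ₚ X* (γ cs (h ∸ 1)) ⊕ cst (2 ∷ 1 ∷ 2 ∷ []))
      × (δ cs h ≈ₚ X* (X* (γ cs (h ∸ 1))) ⊕ cst (1 ∷ 2 ∷ 1 ∷ 1 ∷ [])))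
theorem4p1 cs zero    ()
theorem4p1 cs (suc h) _ =
  α-recurrence cs h , recurrences-case1 cs h , recurrences-case2 cs h , recurrences-case3 cs h
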